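{- For every $k\ge 1$, \[ \sum_{\substack{S\in\mathsf{SSYT}_{(k,k,k)}\\ \mathsf{type}(S)=T_b}} s_{\mathsf{shape}(S)}=\sum_{\substack{S\in\mathsf{SSYT}_{(k,k,k)}\\ \mathsf{type}(S)=T_c}} s_{\mathsf{shape}(S)}, \] where $T_b$ is the standard tableau with row 1 $=1,2$ and row 2 $=3$, and $T_c$ is the standard tableau with row 1 $=1,3$ and row 2 $=2$.
   Context: $s_\lambda$ is the Schur function. Tableaux: rows numbered from the longest row 1; entries weakly increase along rows and strictly increase from row $i$ to row $i+1$ in each column. $\mathsf{SSYT}_{(k,k,k)}$ is the set of semistandard tableaux with exactly $k$ entries each equal to $1,2,3$. Standard tableaux of size 3: $T_a$ (row $1,2,3$), $T_b$, $T_c$ as in the claim, and $T_d$ (column with entries $1,2,3$); transposes $T_a^t=T_d$, $T_d^t=T_a$, $T_b^t=T_c$, $T_c^t=T_b$. For $S\in\mathsf{SSYT}_{(k,k,k)}$ let $N_r$ be the number of entries $r$ in row 2. $\mathsf{type}(S)$ is defined by: (1) if $k=1$ and $S$ is standard, $\mathsf{type}(S)=S$; (2) otherwise if $S$ has at most two rows: $T_a$ if $N_2$ even, $N_3\ge 2N_2$, $N_3\ne 2N_2+1$; $T_d$ if $N_2$ odd, $N_3\ge 2N_2$, $N_3\ne 2N_2+1$; $T_b$ if $N_2$ even and ($N_3<2N_2$ or $N_3=2N_2+1$); $T_c$ if $N_2$ odd and ($N_3<2N_2$ or $N_3=2N_2+1$); (3) if $S$ has three rows, $\mathsf{type}(S)=\mathsf{type}(\overline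 S)^t$, where $\overline S\in\mathsf{SSYT}_{(k-1,k-1,k-1)}$ is $S$ with its first column removed. -}

module Defs where

open import Data.Bool using (Bool; true; false; _∧_; _∨_; not; if_then_else_)
open import Data.Nat using (ℕ; zero; suc; _+_; _*_; _≡ᵇ_; _<ᵇ_; _≤ᵇ_)
open import Data.Nat.Base using (_%_)
open import Data.List using (List; []; _∷_; map; length; filterᵇ; concatMap; upTo; replicate; _++_)
open import Data.Nat.ListAction using (sum)
open import Data.Maybe using (Maybe; just; nothing)

-- A tableau is the list of its rows (row 1 = longest row first), each row a list of entries.
Tableau : Set
Tableau = List (List ℕ)

shape : Tableau → List ℕ
shape = map length

nonEmpty : List ℕ → Bool
nonEmpty []      = false
nonEmpty (_ ∷ _) = true

positive : List ℕ → Bool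
positive []       = true
positive (x ∷ xs) = (1 ≤ᵇ x) ∧ positive xs

weaklyIncr : List ℕ → Bool
weaklyIncr []           = true
weaklyIncr (x ∷ [])     = true
weaklyIncr (x ∷ y ∷ xs) = (x ≤ᵇ y) ∧ weaklyIncr (y ∷ xs)

strictBelow : List ℕ → List ℕ → Bool
strictBelow _        []       = true
strictBelow []       (_ ∷ _)  = false
strictBelow (x ∷ xs) (y ∷ ys) = (x <ᵇ y) ∧ strictBelow xs ys

rowsOK : Tableau → Bool
rowsOK []       = true
rowsOK (r ∷ rs) = nonEmpty r ∧ positive r ∧ weaklyIncr r ∧ rowsOK rs

colsOK : Tableau → Bool
colsOK []             = true
colsOK (r ∷ [])       = true
colsOK (r ∷ r' ∷ rs)  = strictBelow r r' ∧ colsOK (r' ∷ rs)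

isSSYT : Tableau → Bool
isSSYT S = rowsOK S ∧ colsOK S

countRow : ℕ → List ℕ → ℕ
countRow v []       = 0
countRow v (x ∷ xs) = (if x ≡ᵇ v then 1 else 0) + countRow v xs

countT : ℕ → Tableau → ℕ
countT v S = sum (map (countRow v) S)

size : Tableau → ℕ
size S = sum (map length S)

hasContentKKK : ℕ → Tableau → Bool
hasContentKKK k S =
  (countT 1 S ≡ᵇ k) ∧ (countT 2 S ≡ᵇ k) ∧ (countT 3 S ≡ᵇ k) ∧ (size S ≡ᵇ 3 * k)

candRows : ℕ → List (List ℕ)
candRows k =
  concatMap (λ a → concatMap (λ b → map (λ c →
      replicate a 1 ++ replicate b 2 ++ replicate c 3)
    (upTo (suc k))) (upTo (suc k))) (upTo (suc k))

-- Candidate tableaux: at most 3 candidate rows (a column strictly increasing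
-- over {1,2,3} has length ≤ 3).  Duplicate-free.
candidates : ℕ → List Tableau
candidates k =
  [] ∷ (map (λ r → r ∷ []) R
     ++ concatMap (λ r₁ → map (λ r₂ → r₁ ∷ r₂ ∷ []) R) R
     ++ concatMap (λ r₁ → concatMap (λ r₂ → map (λ r₃ → r₁ ∷ r₂ ∷ r₃ ∷ []) R) R) R)
  where R = candRows k

SSYTkkk : ℕ → List Tableau
SSYTkkk k = filterᵇ (λ S → isSSYT S ∧ hasContentKKK k S) (candidates k)

data Std3 : Set where
  Ta Tb Tc Td : Std3
-- Ta = row 1,2,3 ; Tb = rows (1,2),(3) ; Tc = rows (1,3),(2) ; Td = column 1,2,3

_ᵗ : Std3 → Std3
Ta ᵗ = Td
Td ᵗ = Ta
Tb ᵗ = Tc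
Tc ᵗ = Tb

_≟ᵇ_ : Std3 → Std3 → Bool
Ta ≟ᵇ Ta = true
Tb ≟ᵇ Tb = true
Tc ≟ᵇ Tc = true
Td ≟ᵇ Td = true
_  ≟ᵇ _  = false

asStandard : Tableau → Maybe Std3
asStandard ((1 ∷ 2 ∷ 3 ∷ []) ∷ [])                     = just Ta
asStandard ((1 ∷ 2 ∷ []) ∷ (3 ∷ []) ∷ [])              = just Tb
asStandard ((1 ∷ 3 ∷ []) ∷ (2 ∷ []) ∷ [])              = just Tc
asStandard ((1 ∷ []) ∷ (2 ∷ []) ∷ (3 ∷ []) ∷ [])       = just Td
asStandard _                                           = nothing

row2 : Tableau → List ℕ
row2 (_ ∷ r ∷ _) = r
row2 _           = []

N : ℕ → Tableau → ℕ
N r S = countRow r (row2 S)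

even : ℕ → Bool
even n = n % 2 ≡ᵇ 0

twoRowType : Tableau → Std3
twoRowType S =
  let n2 = N 2 S ; n3 = N 3 S
      big = (2 * n2 ≤ᵇ n3) ∧ not (n3 ≡ᵇ 2 * n2 + 1)
  in if big then (if even n2 then Ta else Td)
            else (if even n2 then Tb else Tc)

removeFirstCol : Tableau → Tableau
removeFirstCol S = filterᵇ nonEmpty (map (Data.List.drop 1) S)

atMostTwoRows : Tableau → Bool
atMostTwoRows S = length S ≤ᵇ 2

fromStandard : Maybe Std3 → Std3 → Std3
fromStandard (just t) _ = t
fromStandard nothing  g = g

generalType : Tableau → Std3 → Std3
generalType S typeSbar = if atMostTwoRows S then twoRowType S else typeSbar ᵗ

-- type(S) for S ∈ SSYT_{(k,k,k)}; the first argument is k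
-- (k = 0 never occurs with k ≥ 1; S̄ ∈ SSYT_{(k-1,k-1,k-1)} uses k-1)
type : ℕ → Tableau → Std3
type zero    S = generalType S Ta
type (suc k) S =
  if suc k ≡ᵇ 1
  then fromStandard (asStandard S) (generalType S ((type k (removeFirstCol S))))
  else generalType S (type k (removeFirstCol S))

-- shapes (with multiplicity) of the S ∈ SSYT_{(k,k,k)} with type(S) = t;
-- Σ_{S, type S = t} s_{shape S} is the formal sum of s_λ over this multiset
shapesOfType : ℕ → Std3 → List (List ℕ)
shapesOfType k t = map shape (filterᵇ (λ S → type k S ≟ᵇ t) (SSYTkkk k))

{-# OPTIONS --safe #-}
-- Fix a shape λ.  An SSYT of content (k,k,k) and shape λ is determined by the number d of 2s in
-- its second row: it is 1ᵏ 2ᵏ⁻ᵈ 3ᵏ⁻ᵉ⁻ᶠ / 2ᵈ 3ᵉ / 3ᶠ with e = λ₂ − d, f = λ₃, and it exists iff d lies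
-- in an interval cut out by linear inequalities.  Removing its first f columns leaves the
-- two-row tableau with parameters (d − f, e), so its type is that of rule (2) for (d − f, e),
-- transposed f times.  Hence the type is Tb or Tc exactly when e < 2(d − f) or e = 2(d − f) + 1,
-- i.e. when d is at least a threshold s, and it is then Tb iff d is even.  Since s + λ₂ is odd,
-- the admissible d ≥ s come in pairs {s + 2j, s + 2j + 1}, one of type Tb and one of type Tc.
-- So every shape occurs equally often on both sides, which gives the permutation.
module Submission where

open import Defs
open import Data.Bool using (Bool; true; false; _∧_; not; T; if_then_else_)
open import Data.Bool.Properties using (T-∧; not-involutive; ∧-assoc; ∧-zeroʳ)
open import Data.Empty using (⊥-elim)
open import Data.List using (List; []; _∷_; _++_; map; concatMap; filterᵇ; applyUpTo; upTo; replicate; length)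
open import Data.List.Membership.Propositional using (_∈_)
open import Data.List.Membership.Propositional.Properties using (∈-∃++)
open import Data.List.Properties using (≡-dec; ∷-injectiveˡ; ∷-injectiveʳ; length-++; length-replicate)
open import Data.List.Relation.Unary.Any using (here; there)
open import Data.List.Relation.Binary.Permutation.Propositional using (_↭_; ↭-refl; ↭-prep; ↭-sym; ↭-trans)
open import Data.List.Relation.Binary.Permutation.Propositional.Properties using (shift; map⁺)
open import Data.Nat using (ℕ; zero; suc; _+_; _*_; _∸_; _≤_; _<_; _≥_; z≤n; s≤s; z<s; s<s; s≤s⁻¹; s<s⁻¹; _%_; _≡ᵇ_; _≤ᵇ_)
open import Data.Nat.DivMod using ([m+n]%n≡m%n)
open import Data.Nat.ListAction using (sum)
open import Data.Nat.ListAction.Properties using (sum-↭)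
open import Data.Nat.Properties
open import Data.Nat.Tactic.RingSolver using (solve-∀)
open import Data.Product using (_×_; _,_; proj₁; proj₂; ∃)
open import Data.Sum using (_⊎_; inj₁; inj₂)
open import Data.Unit using (tt)
open import Function using (_∘_; id; _⇔_; mk⇔; Equivalence)
open import Relation.Binary.Definitions using (DecidableEquality)
open import Relation.Binary.PropositionalEquality
open import Relation.Nullary using (¬_; does; yes; no)

-- Indicators and finite sums

𝟙 : Bool → ℕ
𝟙 b = if b then 1 else 0

𝟙≢0⇒T : ∀ b → 𝟙 b ≢ 0 → T b
𝟙≢0⇒T true  _  = _
𝟙≢0⇒T false ne = ne refl

¬T⇒𝟙≡0 : ∀ b → ¬ T b → 𝟙 b ≡ 0
¬T⇒𝟙≡0 true  ¬b = ⊥-elim (¬b _)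
¬T⇒𝟙≡0 false _  = refl

T-extensional : ∀ a b → (T a → T b) → (T b → T a) → a ≡ b
T-extensional true  true  _ _ = refl
T-extensional true  false f _ = ⊥-elim (f _)
T-extensional false true  _ g = ⊥-elim (g _)
T-extensional false false _ _ = refl

T-∧⁻ : ∀ a {b} → T (a ∧ b) → T a × T b
T-∧⁻ a = Equivalence.to (T-∧ {a})

T-∧⁺ : ∀ a {b} → T a → T b → T (a ∧ b)
T-∧⁺ a p q = Equivalence.from (T-∧ {a}) (p , q)

∧-congˡ-T : ∀ a {b c} → (T a → b ≡ c) → a ∧ b ≡ a ∧ c
∧-congˡ-T true  eq = eq _
∧-congˡ-T false _  = refl

module _ {A : Set} where

  ∑ : (A → ℕ) → List A → ℕ
  ∑ F xs = sum (map F xs)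

  ∑-++ : ∀ F xs ys → ∑ F (xs ++ ys) ≡ ∑ F xs + ∑ F ys
  ∑-++ F []       ys = refl
  ∑-++ F (x ∷ xs) ys = trans (cong (F x +_) (∑-++ F xs ys)) (sym (+-assoc (F x) _ _))

  ∑-↭ : ∀ F {xs ys} → xs ↭ ys → ∑ F xs ≡ ∑ F ys
  ∑-↭ F p = sum-↭ (map⁺ F p)

  ∑-filterᵇ : ∀ F p xs → ∑ F (filterᵇ p xs) ≡ ∑ (λ x → if p x then F x else 0) xs
  ∑-filterᵇ F p []       = refl
  ∑-filterᵇ F p (x ∷ xs) with p x
  ... | true  = cong (F x +_) (∑-filterᵇ F p xs)
  ... | false = ∑-filterᵇ F p xs

  ∑-cong : ∀ {F G} → (∀ x → F x ≡ G x) → ∀ xs → ∑ F xs ≡ ∑ G xs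
  ∑-cong eq []       = refl
  ∑-cong eq (x ∷ xs) = cong₂ _+_ (eq x) (∑-cong eq xs)

module _ {A B : Set} where

  ∑-map : ∀ F (g : A → B) xs → ∑ F (map g xs) ≡ ∑ (F ∘ g) xs
  ∑-map F g []       = refl
  ∑-map F g (x ∷ xs) = cong (F (g x) +_) (∑-map F g xs)

  ∑-concatMap : ∀ F (g : A → List B) xs → ∑ F (concatMap g xs) ≡ ∑ (∑ F ∘ g) xs
  ∑-concatMap F g []       = refl
  ∑-concatMap F g (x ∷ xs) =
    trans (∑-++ F (g x) (concatMap g xs)) (cong (∑ F (g x) +_) (∑-concatMap F g xs))

∑< : ℕ → (ℕ → ℕ) → ℕ
∑< zero    h = 0
∑< (suc n) h = h 0 + ∑< n (h ∘ suc)

∑-applyUpTo : ∀ {A : Set} F (g : ℕ → A) n → ∑ F (applyUpTo g n) ≡ ∑< n (F ∘ g)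
∑-applyUpTo F g zero    = refl
∑-applyUpTo F g (suc n) = cong (F (g 0) +_) (∑-applyUpTo F (g ∘ suc) n)

∑<-cong : ∀ n {h g} → (∀ i → i < n → h i ≡ g i) → ∑< n h ≡ ∑< n g
∑<-cong zero    eq = refl
∑<-cong (suc n) eq = cong₂ _+_ (eq 0 z<s) (∑<-cong n (λ i i<n → eq (suc i) (s<s i<n)))

∑<-zero : ∀ n {h} → (∀ i → i < n → h i ≡ 0) → ∑< n h ≡ 0
∑<-zero zero    eq = refl
∑<-zero (suc n) eq = cong₂ _+_ (eq 0 z<s) (∑<-zero n λ i i<n → eq (suc i) (s<s i<n))

∑<-nonzero : ∀ n h → ∑< n h ≢ 0 → ∃ λ i → h i ≢ 0
∑<-nonzero zero    h ne = ⊥-elim (ne refl)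
∑<-nonzero (suc n) h ne with h 0 ≟ 0
... | no  h0≢0 = 0 , h0≢0
... | yes h0≡0 with ∑<-nonzero n (h ∘ suc) (λ eq → ne (cong₂ _+_ h0≡0 eq))
...   | i , hi≢0 = suc i , hi≢0

∑<-single : ∀ n {h} j → (∀ i → h i ≢ 0 → i ≡ j × i < n) → ∑< n h ≡ h j
∑<-single zero {h} j supp with h j ≟ 0
... | yes hj≡0 = sym hj≡0
... | no  hj≢0 = ⊥-elim (n≮0 (proj₂ (supp j hj≢0)))
∑<-single (suc n) {h} zero supp =
  trans (cong (h 0 +_) (∑<-zero n rest≡0)) (+-identityʳ (h 0))
  where
  rest≡0 : ∀ i → i < n → h (suc i) ≡ 0
  rest≡0 i _ with h (suc i) ≟ 0
  ... | yes eq = eq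
  ... | no  ne = ⊥-elim (1+n≢0 (proj₁ (supp (suc i) ne)))
∑<-single (suc n) {h} (suc j) supp =
  trans (cong (_+ ∑< n (h ∘ suc)) h0≡0)
        (∑<-single n j λ i ne → let i≡j , i<n = supp (suc i) ne in suc-injective i≡j , s<s⁻¹ i<n)
  where
  h0≡0 : h 0 ≡ 0
  h0≡0 with h 0 ≟ 0
  ... | yes eq = eq
  ... | no  ne = ⊥-elim (0≢1+n (proj₁ (supp 0 ne)))

∑<-snoc : ∀ n h → ∑< (suc n) h ≡ ∑< n h + h n
∑<-snoc zero    h = +-comm (h 0) 0
∑<-snoc (suc n) h = trans (cong (h 0 +_) (∑<-snoc n (h ∘ suc))) (sym (+-assoc (h 0) _ _))

∑<-extend : ∀ {n} m h → n ≤ m → (∀ i → n ≤ i → h i ≡ 0) → ∑< m h ≡ ∑< n h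
∑<-extend zero h z≤n _ = refl
∑<-extend {n} (suc m) h n≤1+m vanish with m≤n⇒m<n∨m≡n n≤1+m
... | inj₂ refl = refl
... | inj₁ n<1+m = begin
  ∑< (suc m) h   ≡⟨ ∑<-snoc m h ⟩
  ∑< m h + h m   ≡⟨ cong₂ _+_ (∑<-extend m h n≤m vanish) (vanish m n≤m) ⟩
  ∑< n h + 0     ≡⟨ +-identityʳ _ ⟩
  ∑< n h         ∎
  where
  open ≡-Reasoning
  n≤m = s≤s⁻¹ n<1+m

∑<-reverse : ∀ n h → ∑< n h ≡ ∑< n (λ i → h (n ∸ suc i))
∑<-reverse zero    h = refl
∑<-reverse (suc n) h = begin
  ∑< (suc n) h                      ≡⟨ ∑<-snoc n h ⟩
  ∑< n h + h n                      ≡⟨ +-comm (∑< n h) (h n) ⟩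
  h n + ∑< n h                      ≡⟨ cong (h n +_) (∑<-reverse n h) ⟩
  h n + ∑< n (λ i → h (n ∸ suc i))  ∎
  where open ≡-Reasoning

∑<-reflect : ∀ k h → ∑< (suc k) (λ b → h (k ∸ b)) ≡ ∑< (suc k) h
∑<-reflect k h = trans (∑<-reverse (suc k) (λ b → h (k ∸ b)))
  (∑<-cong (suc k) λ d d<1+k → cong h (m∸[m∸n]≡n (s≤s⁻¹ d<1+k)))

∑³ : ℕ → (ℕ → ℕ → ℕ → ℕ) → ℕ
∑³ n G = ∑< n (λ a → ∑< n (λ b → ∑< n (λ c → G a b c)))

∑³-cong : ∀ n {G G′} → (∀ a b c → G a b c ≡ G′ a b c) → ∑³ n G ≡ ∑³ n G′
∑³-cong n eq = ∑<-cong n λ a _ → ∑<-cong n λ b _ → ∑<-cong n λ c _ → eq a b c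

∑³-zero : ∀ n {G} → (∀ a b c → G a b c ≡ 0) → ∑³ n G ≡ 0
∑³-zero n eq = ∑<-zero n λ a _ → ∑<-zero n λ b _ → ∑<-zero n λ c _ → eq a b c

∑³-line : ∀ n {G} a₀ (c₀ : ℕ → ℕ) →
          (∀ a b c → G a b c ≢ 0 → (a ≡ a₀ × c ≡ c₀ b) × (a < n × c < n)) →
          ∑³ n G ≡ ∑< n (λ b → G a₀ b (c₀ b))
∑³-line n {G} a₀ c₀ supp =
  trans (∑<-cong n λ a _ → ∑<-cong n λ b _ → ∑<-single n (c₀ b) λ c ne →
           let (_ , c≡) , (_ , c<n) = supp a b c ne in c≡ , c<n)
        (∑<-single n a₀ λ a ne →
           let b , ne′ = ∑<-nonzero n _ ne ; (a≡ , _) , (a<n , _) = supp a b (c₀ b) ne′ in a≡ , a<n)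

∑³-single : ∀ n {G} a₀ b₀ c₀ →
            (∀ a b c → G a b c ≢ 0 → (a ≡ a₀ × b ≡ b₀ × c ≡ c₀) × (a < n × b < n × c < n)) →
            ∑³ n G ≡ G a₀ b₀ c₀
∑³-single n {G} a₀ b₀ c₀ supp =
  trans (∑³-line n a₀ (λ _ → c₀) λ a b c ne →
           let (a≡ , _ , c≡) , (a<n , _ , c<n) = supp a b c ne in (a≡ , c≡) , (a<n , c<n))
        (∑<-single n b₀ λ b ne → let (_ , b≡ , _) , (_ , b<n , _) = supp a₀ b c₀ ne in b≡ , b<n)

-- Permutations from multiplicities

module _ {A : Set} (_≟_ : DecidableEquality A) where

  multiplicity : A → List A → ℕ
  multiplicity z = ∑ (λ w → 𝟙 (does (z ≟ w)))

  private
    multiplicity-self : ∀ x xs → multiplicity x (x ∷ xs) ≡ suc (multiplicity x xs)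
    multiplicity-self x xs with x ≟ x
    ... | yes _  = refl
    ... | no x≢x = ⊥-elim (x≢x refl)

    multiplicity≢0⇒∈ : ∀ z xs → multiplicity z xs ≢ 0 → z ∈ xs
    multiplicity≢0⇒∈ z []       ne = ⊥-elim (ne refl)
    multiplicity≢0⇒∈ z (x ∷ xs) ne with z ≟ x
    ... | yes refl = here refl
    ... | no  _    = there (multiplicity≢0⇒∈ z xs ne)

  ↭-from-multiplicity : ∀ xs ys → (∀ z → multiplicity z xs ≡ multiplicity z ys) → xs ↭ ys
  ↭-from-multiplicity []       []       _  = ↭-refl
  ↭-from-multiplicity []       (y ∷ ys) eq = ⊥-elim (0≢1+n (trans (eq y) (multiplicity-self y ys)))
  ↭-from-multiplicity (x ∷ xs) ys       eq
    with ∈-∃++ (multiplicity≢0⇒∈ x ys λ m≡0 → 0≢1+n (trans (sym m≡0) (trans (sym (eq x)) (multiplicity-self x xs))))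
  ... | as , bs , refl =
    ↭-trans (↭-prep x (↭-from-multiplicity xs (as ++ bs) eq′)) (↭-sym (shift x as bs))
    where
    eq′ : ∀ z → multiplicity z xs ≡ multiplicity z (as ++ bs)
    eq′ z = +-cancelˡ-≡ (𝟙 (does (z ≟ x))) _ _ (trans (eq z) (∑-↭ _ (shift x as bs)))

-- Parity, the hook condition and the pairing of admissible d

isEven : ℕ → Bool
isEven zero    = true
isEven (suc n) = not (isEven n)

isEven-double+ : ∀ j n → isEven ((j + j) + n) ≡ isEven n
isEven-double+ zero    n = refl
isEven-double+ (suc j) n = begin
  isEven ((suc j + suc j) + n)      ≡⟨ cong (λ x → isEven (suc x + n)) (+-suc j j) ⟩
  not (not (isEven ((j + j) + n)))  ≡⟨ not-involutive _ ⟩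
  isEven ((j + j) + n)              ≡⟨ isEven-double+ j n ⟩
  isEven n                          ∎
  where open ≡-Reasoning

odd⇒≢double : ∀ {n} f → isEven (n + 2 * f) ≡ false → ∀ a → n ≢ a + a
odd⇒≢double {n} f odd a refl = true≢false (begin
  true                                   ≡⟨ sym (isEven-double+ (a + f) 0) ⟩
  isEven ((a + f) + (a + f) + 0)         ≡⟨ cong isEven (regroup a f) ⟩
  isEven (a + a + 2 * f)                 ≡⟨ odd ⟩
  false                                  ∎)
  where
  true≢false : true ≢ false
  true≢false ()
  open ≡-Reasoning
  regroup : ∀ a f → (a + f) + (a + f) + 0 ≡ a + a + 2 * f
  regroup = solve-∀

-- The test of rule (2) (the `big` of twoRowType) that selects Ta or Td.
big : ℕ → ℕ → Bool
big g e = (2 * g ≤ᵇ e) ∧ not (e ≡ᵇ 2 * g + 1)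

not-big⇔ : ∀ g e → T (not (big g e)) ⇔ (e < 2 * g ⊎ e ≡ 2 * g + 1)
not-big⇔ g e = mk⇔ to from
  where
  to : T (not (big g e)) → e < 2 * g ⊎ e ≡ 2 * g + 1
  to p with 2 * g ≤ᵇ e in eq | e ≡ᵇ 2 * g + 1 in eq′
  ... | false | _    = inj₁ (≰⇒> λ 2g≤e → subst T eq (≤⇒≤ᵇ 2g≤e))
  ... | true  | true = inj₂ (≡ᵇ⇒≡ e _ (subst T (sym eq′) _))
  from : e < 2 * g ⊎ e ≡ 2 * g + 1 → T (not (big g e))
  from (inj₁ e<2g) with 2 * g ≤ᵇ e in eq
  ... | false = _
  ... | true  = ⊥-elim (<⇒≱ e<2g (≤ᵇ⇒≤ (2 * g) e (subst T (sym eq) _)))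
  from (inj₂ e≡2g+1) = not-∧-not (2 * g ≤ᵇ e) (≡⇒≡ᵇ e _ e≡2g+1)
    where
    not-∧-not : ∀ a {x} → T x → T (not (a ∧ not x))
    not-∧-not false _ = _
    not-∧-not true {true} _ = _

-- threshold y is the least d with y < 3 d or y ≡ 3 d + 1.
threshold : ℕ → ℕ
threshold zero                = 1
threshold (suc zero)          = 0
threshold (suc (suc zero))    = 1
threshold (suc (suc (suc y))) = suc (threshold y)

threshold-≤⇒ : ∀ y d → threshold y ≤ d → y < 3 * d ⊎ y ≡ 3 * d + 1
threshold-≤⇒ 0 (suc d) _ = inj₁ (subst (0 <_) (sym (*-suc 3 d)) z<s)
threshold-≤⇒ 1 zero    _ = inj₂ refl
threshold-≤⇒ 1 (suc d) _ = inj₁ (subst (1 <_) (sym (*-suc 3 d)) (s<s z<s))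
threshold-≤⇒ 2 (suc d) _ = inj₁ (subst (2 <_) (sym (*-suc 3 d)) (s<s (s<s z<s)))
threshold-≤⇒ (suc (suc (suc y))) (suc d) (s≤s t≤d) with threshold-≤⇒ y d t≤d
... | inj₁ y<3d = inj₁ (subst (3 + y <_) (sym (*-suc 3 d)) (+-monoʳ-< 3 y<3d))
... | inj₂ y≡   = inj₂ (trans (cong (3 +_) y≡) (cong (_+ 1) (sym (*-suc 3 d))))

threshold-≤⇐ : ∀ y d → y < 3 * d ⊎ y ≡ 3 * d + 1 → threshold y ≤ d
threshold-≤⇐ 0 zero    (inj₁ ())
threshold-≤⇐ 0 zero    (inj₂ ())
threshold-≤⇐ 0 (suc d) _ = s≤s z≤n
threshold-≤⇐ 1 d       _ = z≤n
threshold-≤⇐ 2 zero    (inj₁ ())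
threshold-≤⇐ 2 zero    (inj₂ ())
threshold-≤⇐ 2 (suc d) _ = s≤s z≤n
threshold-≤⇐ (suc (suc (suc y))) zero (inj₁ ())
threshold-≤⇐ (suc (suc (suc y))) zero (inj₂ ())
threshold-≤⇐ (suc (suc (suc y))) (suc d) p = s≤s (threshold-≤⇐ y d (peel p))
  where
  peel : 3 + y < 3 * suc d ⊎ 3 + y ≡ 3 * suc d + 1 → y < 3 * d ⊎ y ≡ 3 * d + 1
  peel (inj₁ lt) = inj₁ (+-cancelˡ-< 3 y _ (subst (3 + y <_) (*-suc 3 d) lt))
  peel (inj₂ eq) = inj₂ (+-cancelˡ-≡ 3 _ _ (trans eq (cong (_+ 1) (*-suc 3 d))))

threshold-3*+ : ∀ f y → threshold (3 * f + y) ≡ f + threshold y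
threshold-3*+ zero    y = refl
threshold-3*+ (suc f) y = trans (cong (λ x → threshold (x + y)) (*-suc 3 f)) (cong suc (threshold-3*+ f y))

threshold-odd : ∀ y → isEven (threshold y + y) ≡ false
threshold-odd 0 = refl
threshold-odd 1 = refl
threshold-odd 2 = refl
threshold-odd (suc (suc (suc y))) =
  trans (cong isEven (add-four (threshold y) y)) (trans (isEven-double+ 2 (threshold y + y)) (threshold-odd y))
  where
  add-four : ∀ t y → suc t + (3 + y) ≡ (2 + 2) + (t + y)
  add-four = solve-∀

threshold-bound : ∀ y → y ≤ 3 * threshold y + 1
threshold-bound y with threshold-≤⇒ y (threshold y) ≤-refl
... | inj₁ y<3t = ≤-trans (<⇒≤ y<3t) (m≤m+n _ 1)
... | inj₂ y≡   = ≤-reflexive y≡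

not-big⇔threshold : ∀ {f d m} → f ≤ d → d ≤ m →
                    T (not (big (d ∸ f) (m ∸ d))) ⇔ threshold (m + 2 * f) ≤ d
not-big⇔threshold {f} {d} {m} f≤d d≤m = mk⇔
  (λ p → ≤-trans (≤-reflexive threshold≡) (≤-trans (+-monoʳ-≤ f (to p)) (≤-reflexive f+g≡d)))
  (λ t≤d → from (+-cancelˡ-≤ f _ _ (≤-trans (≤-reflexive (sym threshold≡)) (≤-trans t≤d (≤-reflexive (sym f+g≡d))))))
  where
  g = d ∸ f
  e = m ∸ d
  f+g≡d : f + g ≡ d
  f+g≡d = m+[n∸m]≡n f≤d
  split : m + 2 * f ≡ 3 * f + (g + e)
  split = begin
    m + 2 * f              ≡⟨ cong (_+ 2 * f) (sym (m+[n∸m]≡n d≤m)) ⟩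
    d + e + 2 * f          ≡⟨ cong (λ x → x + e + 2 * f) (sym f+g≡d) ⟩
    f + g + e + 2 * f      ≡⟨ rearrange f g e ⟩
    3 * f + (g + e)        ∎
    where
    open ≡-Reasoning
    rearrange : ∀ f g e → f + g + e + 2 * f ≡ 3 * f + (g + e)
    rearrange = solve-∀
  threshold≡ : threshold (m + 2 * f) ≡ f + threshold (g + e)
  threshold≡ = trans (cong threshold split) (threshold-3*+ f (g + e))
  3g : ∀ g → 3 * g ≡ g + 2 * g
  3g = solve-∀
  to : T (not (big g e)) → threshold (g + e) ≤ g
  to p = threshold-≤⇐ (g + e) g (widen (Equivalence.to (not-big⇔ g e) p))
    where
    widen : e < 2 * g ⊎ e ≡ 2 * g + 1 → g + e < 3 * g ⊎ g + e ≡ 3 * g + 1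
    widen (inj₁ lt) = inj₁ (subst (g + e <_) (sym (3g g)) (+-monoʳ-< g lt))
    widen (inj₂ eq) = inj₂ (trans (cong (g +_) eq) (trans (sym (+-assoc g (2 * g) 1)) (cong (_+ 1) (sym (3g g)))))
  from : threshold (g + e) ≤ g → T (not (big g e))
  from t≤g = Equivalence.from (not-big⇔ g e) (narrow (threshold-≤⇒ (g + e) g t≤g))
    where
    narrow : g + e < 3 * g ⊎ g + e ≡ 3 * g + 1 → e < 2 * g ⊎ e ≡ 2 * g + 1
    narrow (inj₁ lt) = inj₁ (+-cancelˡ-< g e _ (subst (g + e <_) (3g g) lt))
    narrow (inj₂ eq) = inj₂ (+-cancelˡ-≡ g _ _ (trans eq (trans (cong (_+ 1) (3g g)) (+-assoc g (2 * g) 1))))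

-- The inequalities making  1ᵏ 2ᵏ⁻ᵈ 3ᵏ⁻ᵉ⁻ᶠ / 2ᵈ 3ᵉ / 3ᶠ  (e = m − d) semistandard of content (k,k,k).
record Legal (k d m f : ℕ) : Set where
  field
    f≤d     : f ≤ d
    d≤m     : d ≤ m
    m+f≤k+d : m + f ≤ k + d
    m+d≤k+k : m + d ≤ k + k
    d≤k     : d ≤ k

legal-suc : ∀ {k d m f} → Legal k d m f → d ≢ m → m + d ≢ k + k → Legal k (suc d) m f
legal-suc {k} {d} {m} L d≢m m+d≢2k = record
  { f≤d     = m≤n⇒m≤1+n f≤d
  ; d≤m     = d<m
  ; m+f≤k+d = ≤-trans m+f≤k+d (+-monoʳ-≤ k (n≤1+n d))
  ; m+d≤k+k = m+1+d≤k+k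
  ; d≤k     = half (≤-trans (+-monoˡ-≤ (suc d) d<m) m+1+d≤k+k)
  }
  where
  open Legal L
  d<m = ≤∧≢⇒< d≤m d≢m
  m+1+d≤k+k : m + suc d ≤ k + k
  m+1+d≤k+k = subst (_≤ k + k) (sym (+-suc m d)) (≤∧≢⇒< m+d≤k+k m+d≢2k)
  half : ∀ {a b} → a + a ≤ b + b → a ≤ b
  half {a} {b} 2a≤2b with a ≤? b
  ... | yes a≤b = a≤b
  ... | no  a≰b = ⊥-elim (<⇒≱ (+-mono-< (≰⇒> a≰b) (≰⇒> a≰b)) 2a≤2b)

legal-pred : ∀ {k d m f} → Legal k (suc d) m f → m + 2 * f < 3 * suc d → Legal k d m f
legal-pred {k} {d} {m} {f} L small = record
  { f≤d     = s≤s⁻¹ (≤∧≢⇒< f≤d f≢1+d)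
  ; d≤m     = ≤-trans (n≤1+n d) d≤m
  ; m+f≤k+d = s≤s⁻¹ (subst (m + f <_) (+-suc k d) (≤∧≢⇒< m+f≤k+d m+f≢k+1+d))
  ; m+d≤k+k = ≤-trans (+-monoʳ-≤ m (n≤1+n d)) m+d≤k+k
  ; d≤k     = ≤-trans (n≤1+n d) d≤k
  }
  where
  open Legal L
  D = suc d
  f≢1+d : f ≢ D
  f≢1+d refl = <⇒≱ small (begin
    3 * D          ≡⟨ 3D D ⟩
    D + 2 * D      ≤⟨ +-monoˡ-≤ (2 * D) d≤m ⟩
    m + 2 * D      ∎)
    where
    open ≤-Reasoning
    3D : ∀ D → 3 * D ≡ D + 2 * D
    3D = solve-∀
  m+f≢k+1+d : m + f ≢ k + D
  m+f≢k+1+d eq = <⇒≱ small (+-cancelˡ-≤ m _ _ (begin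
    m + 3 * D                ≡⟨ r₁ m D ⟩
    (m + D) + 2 * D          ≤⟨ +-monoˡ-≤ (2 * D) m+d≤k+k ⟩
    (k + k) + 2 * D          ≡⟨ r₂ k D ⟩
    (k + D) + (k + D)        ≡⟨ cong₂ _+_ (sym eq) (sym eq) ⟩
    (m + f) + (m + f)        ≡⟨ r₃ m f ⟩
    m + (m + 2 * f)          ∎))
    where
    open ≤-Reasoning
    r₁ : ∀ m D → m + 3 * D ≡ (m + D) + 2 * D
    r₁ = solve-∀
    r₂ : ∀ k D → (k + k) + 2 * D ≡ (k + D) + (k + D)
    r₂ = solve-∀
    r₃ : ∀ m f → (m + f) + (m + f) ≡ m + (m + 2 * f)
    r₃ = solve-∀

Hooked : ℕ → ℕ → ℕ → ℕ → Set
Hooked k m f d = Legal k d m f × threshold (m + 2 * f) ≤ d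

-- Legality of d = s + 2j and of d + 1 could only differ if d = m or m + d = k + k (excluded: s + m
-- is odd) or if m + 2f ≥ 3(d + 1) (excluded: d ≥ s).
hooked-pair : ∀ {k m f} j → let d = threshold (m + 2 * f) + (j + j) in
              Hooked k m f d ⇔ Hooked k m f (suc d)
hooked-pair {k} {m} {f} j = mk⇔
  (λ (L , s≤d) → legal-suc L d≢m (odd⇒≢double f odd k) , m≤n⇒m≤1+n s≤d)
  (λ (L , _) → legal-pred L d+1>X , m≤m+n s (j + j))
  where
  X = m + 2 * f
  s = threshold X
  d = s + (j + j)
  odd : isEven (m + d + 2 * f) ≡ false
  odd = trans (cong isEven (r m s j f)) (trans (isEven-double+ j (s + X)) (threshold-odd X))
    where
    r : ∀ m s j f → m + (s + (j + j)) + 2 * f ≡ (j + j) + (s + (m + 2 * f))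
    r = solve-∀
  d≢m : d ≢ m
  d≢m d≡m = odd⇒≢double f odd m (cong (m +_) d≡m)
  d+1>X : X < 3 * suc d
  d+1>X = begin-strict
    X             ≤⟨ threshold-bound X ⟩
    3 * s + 1     ≤⟨ +-monoˡ-≤ 1 (*-monoʳ-≤ 3 (m≤m+n s (j + j))) ⟩
    3 * d + 1     ≡⟨ +-comm (3 * d) 1 ⟩
    1 + 3 * d     <⟨ +-monoˡ-< (3 * d) {1} {3} (s<s z<s) ⟩
    3 + 3 * d     ≡⟨ sym (*-suc 3 d) ⟩
    3 * suc d     ∎
    where open ≤-Reasoning

module _ (h : ℕ → Bool) (s : ℕ) (h⇒s≤ : ∀ d → T (h d) → s ≤ d)
         (pairs : ∀ j → h (s + (j + j)) ≡ h (suc (s + (j + j)))) where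

  private
    E O : ℕ → ℕ
    E n = ∑< n (λ d → 𝟙 (h d ∧ isEven d))
    O n = ∑< n (λ d → 𝟙 (h d ∧ not (isEven d)))

    ∑<-+2 : ∀ n g → ∑< (suc (suc n)) g ≡ ∑< n g + (g n + g (suc n))
    ∑<-+2 n g = trans (∑<-snoc (suc n) g) (trans (cong (_+ g (suc n)) (∑<-snoc n g)) (+-assoc (∑< n g) _ _))

    below-s : ∀ d (p : ℕ → Bool) → d < s → 𝟙 (h d ∧ p d) ≡ 0
    below-s d p d<s with h d in eq
    ... | false = refl
    ... | true  = ⊥-elim (<⇒≱ d<s (h⇒s≤ d (subst T (sym eq) _)))

    pair : ∀ b e → 𝟙 (b ∧ e) + 𝟙 (b ∧ not e) ≡ 𝟙 (b ∧ not e) + 𝟙 (b ∧ not (not e))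
    pair false e     = refl
    pair true  false = refl
    pair true  true  = refl

    balanced-upto : ∀ j → E (s + (j + j)) ≡ O (s + (j + j))
    balanced-upto zero = begin
      E (s + 0)   ≡⟨ ∑<-zero (s + 0) (λ d d<s → below-s d isEven (subst (d <_) (+-identityʳ s) d<s)) ⟩
      0           ≡⟨ sym (∑<-zero (s + 0) (λ d d<s → below-s d (not ∘ isEven) (subst (d <_) (+-identityʳ s) d<s))) ⟩
      O (s + 0)   ∎
      where open ≡-Reasoning
    balanced-upto (suc j) = begin
      E (s + (suc j + suc j))
        ≡⟨ cong E index≡ ⟩
      E (suc (suc d₀))
        ≡⟨ ∑<-+2 d₀ _ ⟩
      E d₀ + (𝟙 (h d₀ ∧ isEven d₀) + 𝟙 (h (suc d₀) ∧ isEven (suc d₀)))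
        ≡⟨ cong₂ _+_ (balanced-upto j) step ⟩
      O d₀ + (𝟙 (h d₀ ∧ not (isEven d₀)) + 𝟙 (h (suc d₀) ∧ not (isEven (suc d₀))))
        ≡⟨ sym (∑<-+2 d₀ _) ⟩
      O (suc (suc d₀))
        ≡⟨ cong O (sym index≡) ⟩
      O (s + (suc j + suc j))
        ∎
      where
      open ≡-Reasoning
      d₀ = s + (j + j)
      index≡ : s + (suc j + suc j) ≡ suc (suc d₀)
      index≡ = trans (cong (λ x → s + suc x) (+-suc j j)) (trans (+-suc s _) (cong suc (+-suc s _)))
      step : 𝟙 (h d₀ ∧ isEven d₀) + 𝟙 (h (suc d₀) ∧ not (isEven d₀))
           ≡ 𝟙 (h d₀ ∧ not (isEven d₀)) + 𝟙 (h (suc d₀) ∧ not (not (isEven d₀)))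
      step rewrite sym (pairs j) = pair (h d₀) (isEven d₀)

  evens≡odds : ∀ n → (∀ d → T (h d) → d < n) →
               ∑< n (λ d → 𝟙 (h d ∧ isEven d)) ≡ ∑< n (λ d → 𝟙 (h d ∧ not (isEven d)))
  evens≡odds n h⇒<n = begin
    E n                  ≡⟨ sym (∑<-extend (s + (n + n)) _ n≤ (beyond isEven)) ⟩
    E (s + (n + n))      ≡⟨ balanced-upto n ⟩
    O (s + (n + n))      ≡⟨ ∑<-extend (s + (n + n)) _ n≤ (beyond (not ∘ isEven)) ⟩
    O n                  ∎
    where
    open ≡-Reasoning
    n≤ : n ≤ s + (n + n)
    n≤ = ≤-trans (m≤m+n n n) (m≤n+m (n + n) s)
    beyond : ∀ p i → n ≤ i → 𝟙 (h i ∧ p i) ≡ 0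
    beyond p i n≤i with h i in eq
    ... | false = refl
    ... | true  = ⊥-elim (<⇒≱ (h⇒<n i (subst T (sym eq) _)) n≤i)

-- In the use below v d says that the tableau with parameter d is an SSYT of the given shape, so h d
-- says that moreover its type is Tb or Tc.
hook-balance : ∀ k m f (v : ℕ → Bool) (C : Set) → (∀ d → T (v d) ⇔ (C × Legal k d m f)) →
               let h = λ d → v d ∧ not (big (d ∸ f) (m ∸ d)) in
               ∑< (suc k) (λ d → 𝟙 (h d ∧ isEven d)) ≡ ∑< (suc k) (λ d → 𝟙 (h d ∧ not (isEven d)))
hook-balance k m f v C legal =
  evens≡odds h s (λ d p → proj₂ (proj₂ (to d p))) pairs (suc k)
             (λ d p → s≤s (Legal.d≤k (proj₁ (proj₂ (to d p)))))
  where
  s = threshold (m + 2 * f)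
  h = λ d → v d ∧ not (big (d ∸ f) (m ∸ d))
  to : ∀ d → T (h d) → C × Hooked k m f d
  to d p = let vd , nb = T-∧⁻ (v d) p ; c , L = Equivalence.to (legal d) vd in
    c , L , Equivalence.to (not-big⇔threshold (Legal.f≤d L) (Legal.d≤m L)) nb
  from : ∀ d → C × Hooked k m f d → T (h d)
  from d (c , L , s≤d) = T-∧⁺ (v d) (Equivalence.from (legal d) (c , L))
    (Equivalence.from (not-big⇔threshold (Legal.f≤d L) (Legal.d≤m L)) s≤d)
  pairs : ∀ j → h (s + (j + j)) ≡ h (suc (s + (j + j)))
  pairs j = T-extensional _ _
    (λ p → let c , H = to _ p in from _ (c , Equivalence.to (hooked-pair j) H))
    (λ p → let c , H = to _ p in from _ (c , Equivalence.from (hooked-pair j) H))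

-- Rows and semistandard tableaux of content (k,k,k)

row : ℕ → ℕ → ℕ → List ℕ
row a b c = replicate a 1 ++ replicate b 2 ++ replicate c 3

positive-row : ∀ a b c → T (positive (row a b c))
positive-row (suc a) b       c       = positive-row a b c
positive-row zero    (suc b) c       = positive-row zero b c
positive-row zero    zero    (suc c) = positive-row zero zero c
positive-row zero    zero    zero    = tt

weaklyIncr-row : ∀ a b c → T (weaklyIncr (row a b c))
weaklyIncr-row (suc (suc a)) b             c             = weaklyIncr-row (suc a) b c
weaklyIncr-row (suc zero)    (suc b)       c             = weaklyIncr-row zero (suc b) c
weaklyIncr-row (suc zero)    zero          (suc c)       = weaklyIncr-row zero zero (suc c)
weaklyIncr-row (suc zero)    zero          zero          = tt
weaklyIncr-row zero          (suc (suc b)) c             = weaklyIncr-row zero (suc b) c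
weaklyIncr-row zero          (suc zero)    (suc c)       = weaklyIncr-row zero zero (suc c)
weaklyIncr-row zero          (suc zero)    zero          = tt
weaklyIncr-row zero          zero          (suc (suc c)) = weaklyIncr-row zero zero (suc c)
weaklyIncr-row zero          zero          (suc zero)    = tt
weaklyIncr-row zero          zero          zero          = tt

count₁-row : ∀ a b c → countRow 1 (row a b c) ≡ a
count₁-row (suc a) b       c       = cong suc (count₁-row a b c)
count₁-row zero    (suc b) c       = count₁-row zero b c
count₁-row zero    zero    (suc c) = count₁-row zero zero c
count₁-row zero    zero    zero    = refl

count₂-row : ∀ a b c → countRow 2 (row a b c) ≡ b
count₂-row (suc a) b       c       = count₂-row a b c
count₂-row zero    (suc b) c       = cong suc (count₂-row zero b c)
count₂-row zero    zero    (suc c) = count₂-row zero zero c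
count₂-row zero    zero    zero    = refl

count₃-row : ∀ a b c → countRow 3 (row a b c) ≡ c
count₃-row (suc a) b       c       = count₃-row a b c
count₃-row zero    (suc b) c       = count₃-row zero b c
count₃-row zero    zero    (suc c) = cong suc (count₃-row zero zero c)
count₃-row zero    zero    zero    = refl

length-row : ∀ a b c → length (row a b c) ≡ a + (b + c)
length-row a b c = begin
  length (row a b c)
    ≡⟨ length-++ (replicate a 1) ⟩
  length (replicate a 1) + length (replicate b 2 ++ replicate c 3)
    ≡⟨ cong₂ _+_ (length-replicate a) (length-++ (replicate b 2)) ⟩
  a + (length (replicate b 2) + length (replicate c 3))
    ≡⟨ cong (a +_) (cong₂ _+_ (length-replicate b) (length-replicate c)) ⟩
  a + (b + c)
    ∎
  where open ≡-Reasoning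

nonEmpty-row⇔ : ∀ a b c → T (nonEmpty (row a b c)) ⇔ 0 < a + (b + c)
nonEmpty-row⇔ a b c = mk⇔ (to a b c) (from a b c)
  where
  to : ∀ a b c → T (nonEmpty (row a b c)) → 0 < a + (b + c)
  to (suc a) b       c       _ = z<s
  to zero    (suc b) c       _ = z<s
  to zero    zero    (suc c) _ = z<s
  from : ∀ a b c → 0 < a + (b + c) → T (nonEmpty (row a b c))
  from (suc a) b       c       _ = tt
  from zero    (suc b) c       _ = tt
  from zero    zero    (suc c) _ = tt

strictBelow-row⇒ : ∀ a₁ b₁ c₁ a₂ b₂ c₂ → T (strictBelow (row a₁ b₁ c₁) (row a₂ b₂ c₂)) →
                   a₂ ≡ 0 × b₂ ≤ a₁ × b₂ + c₂ ≤ a₁ + b₁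
strictBelow-row⇒ (suc a₁) b₁       c₁       (suc a₂) b₂       c₂       ()
strictBelow-row⇒ zero     (suc b₁) c₁       (suc a₂) b₂       c₂       ()
strictBelow-row⇒ zero     zero     (suc c₁) (suc a₂) b₂       c₂       ()
strictBelow-row⇒ zero     zero     zero     (suc a₂) b₂       c₂       ()
strictBelow-row⇒ (suc a₁) b₁       c₁       zero     (suc b₂) c₂       p
  with refl , b₂≤a₁ , ≤a₁+b₁ ← strictBelow-row⇒ a₁ b₁ c₁ zero b₂ c₂ p = refl , s≤s b₂≤a₁ , s≤s ≤a₁+b₁
strictBelow-row⇒ zero     (suc b₁) c₁       zero     (suc b₂) c₂       ()
strictBelow-row⇒ zero     zero     (suc c₁) zero     (suc b₂) c₂       ()
strictBelow-row⇒ zero     zero     zero     zero     (suc b₂) c₂       ()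
strictBelow-row⇒ (suc a₁) b₁       c₁       zero     zero     (suc c₂) p
  with refl , _ , ≤a₁+b₁ ← strictBelow-row⇒ a₁ b₁ c₁ zero zero c₂ p = refl , z≤n , s≤s ≤a₁+b₁
strictBelow-row⇒ zero     (suc b₁) c₁       zero     zero     (suc c₂) p
  with refl , _ , ≤b₁ ← strictBelow-row⇒ zero b₁ c₁ zero zero c₂ p = refl , z≤n , s≤s ≤b₁
strictBelow-row⇒ zero     zero     (suc c₁) zero     zero     (suc c₂) ()
strictBelow-row⇒ zero     zero     zero     zero     zero     (suc c₂) ()
strictBelow-row⇒ a₁       b₁       c₁       zero     zero     zero     _ = refl , z≤n , z≤n

strictBelow-row⇐ : ∀ a₁ b₁ c₁ b₂ c₂ → b₂ ≤ a₁ → b₂ + c₂ ≤ a₁ + b₁ →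
                   T (strictBelow (row a₁ b₁ c₁) (row 0 b₂ c₂))
strictBelow-row⇐ (suc a₁) b₁       c₁ (suc b₂) c₂       (s≤s p) (s≤s q) = strictBelow-row⇐ a₁ b₁ c₁ b₂ c₂ p q
strictBelow-row⇐ (suc a₁) b₁       c₁ zero     (suc c₂) _       (s≤s q) = strictBelow-row⇐ a₁ b₁ c₁ zero c₂ z≤n q
strictBelow-row⇐ zero     (suc b₁) c₁ zero     (suc c₂) _       (s≤s q) = strictBelow-row⇐ zero b₁ c₁ zero c₂ z≤n q
strictBelow-row⇐ a₁       b₁       c₁ zero     zero     _       _       = tt

isSSYTkkk : ℕ → Tableau → Bool
isSSYTkkk k S = isSSYT S ∧ hasContentKKK k S

Content : ℕ → Tableau → Set
Content k S = countT 1 S ≡ k × countT 2 S ≡ k × countT 3 S ≡ k × size S ≡ 3 * k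

isSSYTkkk⇔ : ∀ k S → T (isSSYTkkk k S) ⇔ ((T (rowsOK S) × T (colsOK S)) × Content k S)
isSSYTkkk⇔ k S = mk⇔
  (λ p → let ssyt , c = T-∧⁻ (isSSYT S) p in T-∧⁻ (rowsOK S) ssyt , content⇒ c)
  (λ ((r , c) , eqs) → T-∧⁺ (isSSYT S) (T-∧⁺ (rowsOK S) r c) (content⇐ eqs))
  where
  content⇒ : T (hasContentKKK k S) → Content k S
  content⇒ p =
    let c₁ , p = T-∧⁻ (countT 1 S ≡ᵇ k) p ; c₂ , p = T-∧⁻ (countT 2 S ≡ᵇ k) p ; c₃ , s = T-∧⁻ (countT 3 S ≡ᵇ k) p
    in ≡ᵇ⇒≡ _ _ c₁ , ≡ᵇ⇒≡ _ _ c₂ , ≡ᵇ⇒≡ _ _ c₃ , ≡ᵇ⇒≡ _ _ s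
  content⇐ : Content k S → T (hasContentKKK k S)
  content⇐ (c₁ , c₂ , c₃ , s) =
    T-∧⁺ (countT 1 S ≡ᵇ k) (≡⇒≡ᵇ _ _ c₁) (T-∧⁺ (countT 2 S ≡ᵇ k) (≡⇒≡ᵇ _ _ c₂)
      (T-∧⁺ (countT 3 S ≡ᵇ k) (≡⇒≡ᵇ _ _ c₃) (≡⇒≡ᵇ _ _ s)))

rowsOK-row∷⇔ : ∀ a b c rs → T (rowsOK (row a b c ∷ rs)) ⇔ (0 < a + (b + c) × T (rowsOK rs))
rowsOK-row∷⇔ a b c rs = mk⇔
  (λ p → let ne , p = T-∧⁻ (nonEmpty r) p ; _ , p = T-∧⁻ (positive r) p ; _ , p = T-∧⁻ (weaklyIncr r) p
         in Equivalence.to (nonEmpty-row⇔ a b c) ne , p)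
  (λ (ne , p) → T-∧⁺ (nonEmpty r) (Equivalence.from (nonEmpty-row⇔ a b c) ne)
                  (T-∧⁺ (positive r) (positive-row a b c) (T-∧⁺ (weaklyIncr r) (weaklyIncr-row a b c) p)))
  where r = row a b c

colsOK-∷∷⇔ : ∀ r r′ rs → T (colsOK (r ∷ r′ ∷ rs)) ⇔ (T (strictBelow r r′) × T (colsOK (r′ ∷ rs)))
colsOK-∷∷⇔ r r′ rs = T-∧ {strictBelow r r′}

valid₁⇒ : ∀ {k a b c} → T (isSSYTkkk k (row a b c ∷ [])) → a ≡ k × b ≡ k × c ≡ k
valid₁⇒ {k} {a} {b} {c} p =
  let _ , n₁ , n₂ , n₃ , _ = Equivalence.to (isSSYTkkk⇔ k (row a b c ∷ [])) p
  in one-row (count₁-row a b c) n₁ , one-row (count₂-row a b c) n₂ , one-row (count₃-row a b c) n₃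
  where
  one-row : ∀ {x y} → x ≡ y → x + 0 ≡ k → y ≡ k
  one-row refl eq = trans (sym (+-identityʳ _)) eq

record Valid₂ (k a₁ b₁ c₁ a₂ b₂ c₂ : ℕ) : Set where
  field
    a₁≡k        : a₁ ≡ k
    a₂≡0        : a₂ ≡ 0
    b₁+b₂≡k     : b₁ + b₂ ≡ k
    c₁+c₂≡k     : c₁ + c₂ ≡ k
    b₂≤a₁       : b₂ ≤ a₁
    b₂+c₂≤a₁+b₁ : b₂ + c₂ ≤ a₁ + b₁
    row₂≢[]     : 0 < b₂ + c₂

record Valid₃ (k a₁ b₁ c₁ a₂ b₂ c₂ a₃ b₃ c₃ : ℕ) : Set where
  field
    a₁≡k        : a₁ ≡ k
    a₂≡0        : a₂ ≡ 0
    a₃≡0        : a₃ ≡ 0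
    b₃≡0        : b₃ ≡ 0
    b₁+b₂≡k     : b₁ + b₂ ≡ k
    c₁+c₂+c₃≡k  : c₁ + (c₂ + c₃) ≡ k
    b₂≤a₁       : b₂ ≤ a₁
    b₂+c₂≤a₁+b₁ : b₂ + c₂ ≤ a₁ + b₁
    c₃≤b₂       : c₃ ≤ b₂
    row₃≢[]     : 0 < c₃

private
  k+k+k≡3k : ∀ k → k + k + k ≡ 3 * k
  k+k+k≡3k = solve-∀

module _ (a₁ b₁ c₁ a₂ b₂ c₂ : ℕ) where

  private
    S = row a₁ b₁ c₁ ∷ row a₂ b₂ c₂ ∷ []

  content-rows₂ : countT 1 S ≡ a₁ + a₂ × countT 2 S ≡ b₁ + b₂ × countT 3 S ≡ c₁ + c₂ ×
                  size S ≡ a₁ + (b₁ + c₁) + (a₂ + (b₂ + c₂))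
  content-rows₂ = pair (count₁-row a₁ b₁ c₁) (count₁-row a₂ b₂ c₂) , pair (count₂-row a₁ b₁ c₁) (count₂-row a₂ b₂ c₂) ,
                  pair (count₃-row a₁ b₁ c₁) (count₃-row a₂ b₂ c₂) , pair (length-row a₁ b₁ c₁) (length-row a₂ b₂ c₂)
    where
    pair : ∀ {x y x′ y′} → x ≡ x′ → y ≡ y′ → x + (y + 0) ≡ x′ + y′
    pair {x} {y} refl refl = cong (x +_) (+-identityʳ y)

module _ (a₁ b₁ c₁ a₂ b₂ c₂ a₃ b₃ c₃ : ℕ) where

  private
    S = row a₁ b₁ c₁ ∷ row a₂ b₂ c₂ ∷ row a₃ b₃ c₃ ∷ []

  content-rows₃ : countT 1 S ≡ a₁ + (a₂ + a₃) × countT 2 S ≡ b₁ + (b₂ + b₃) × countT 3 S ≡ c₁ + (c₂ + c₃) ×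
                  size S ≡ a₁ + (b₁ + c₁) + ((a₂ + (b₂ + c₂)) + (a₃ + (b₃ + c₃)))
  content-rows₃ = triple (count₁-row a₁ b₁ c₁) (count₁-row a₂ b₂ c₂) (count₁-row a₃ b₃ c₃) ,
                  triple (count₂-row a₁ b₁ c₁) (count₂-row a₂ b₂ c₂) (count₂-row a₃ b₃ c₃) ,
                  triple (count₃-row a₁ b₁ c₁) (count₃-row a₂ b₂ c₂) (count₃-row a₃ b₃ c₃) ,
                  triple (length-row a₁ b₁ c₁) (length-row a₂ b₂ c₂) (length-row a₃ b₃ c₃)
    where
    triple : ∀ {x y z x′ y′ z′} → x ≡ x′ → y ≡ y′ → z ≡ z′ → x + (y + (z + 0)) ≡ x′ + (y′ + z′)
    triple {x} {y} {z} refl refl refl = cong (λ t → x + (y + t)) (+-identityʳ z)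

module _ {k a₁ b₁ c₁ a₂ b₂ c₂ : ℕ} where

  private
    r₁ = row a₁ b₁ c₁
    r₂ = row a₂ b₂ c₂

  valid₂⇒ : T (isSSYTkkk k (r₁ ∷ r₂ ∷ [])) → Valid₂ k a₁ b₁ c₁ a₂ b₂ c₂
  valid₂⇒ p
    with (rows , cols) , n₁ , n₂ , n₃ , _ ← Equivalence.to (isSSYTkkk⇔ k (r₁ ∷ r₂ ∷ [])) p
    with refl , b₂≤a₁ , b₂+c₂≤ ← strictBelow-row⇒ a₁ b₁ c₁ a₂ b₂ c₂ (proj₁ (Equivalence.to (colsOK-∷∷⇔ r₁ r₂ []) cols))
    = let ones , twos , threes , _ = content-rows₂ a₁ b₁ c₁ 0 b₂ c₂ in record
    { a₁≡k        = trans (sym (+-identityʳ a₁)) (trans (sym ones) n₁)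
    ; a₂≡0        = refl
    ; b₁+b₂≡k     = trans (sym twos) n₂
    ; c₁+c₂≡k     = trans (sym threes) n₃
    ; b₂≤a₁       = b₂≤a₁
    ; b₂+c₂≤a₁+b₁ = b₂+c₂≤
    ; row₂≢[]     = proj₁ (Equivalence.to (rowsOK-row∷⇔ 0 b₂ c₂ [])
                                          (proj₂ (Equivalence.to (rowsOK-row∷⇔ a₁ b₁ c₁ (r₂ ∷ [])) rows)))
    }

  valid₂⇐ : 0 < k → Valid₂ k a₁ b₁ c₁ a₂ b₂ c₂ → T (isSSYTkkk k (r₁ ∷ r₂ ∷ []))
  valid₂⇐ 0<k record { a₁≡k = refl ; a₂≡0 = refl ; b₁+b₂≡k = b≡ ; c₁+c₂≡k = c≡
                     ; b₂≤a₁ = b₂≤a₁ ; b₂+c₂≤a₁+b₁ = b₂+c₂≤ ; row₂≢[] = row₂≢[] } =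
    Equivalence.from (isSSYTkkk⇔ k (r₁ ∷ r₂ ∷ []))
      ( ( Equivalence.from (rowsOK-row∷⇔ k b₁ c₁ (r₂ ∷ []))
            (≤-trans 0<k (m≤m+n k _) , Equivalence.from (rowsOK-row∷⇔ 0 b₂ c₂ []) (row₂≢[] , tt))
        , Equivalence.from (colsOK-∷∷⇔ r₁ r₂ []) (strictBelow-row⇐ k b₁ c₁ b₂ c₂ b₂≤a₁ b₂+c₂≤ , tt) )
      , trans ones (+-identityʳ k) , trans twos b≡ , trans threes c≡
      , (begin
          size (r₁ ∷ r₂ ∷ [])           ≡⟨ size≡ ⟩
          k + (b₁ + c₁) + (b₂ + c₂)     ≡⟨ regroup k b₁ c₁ b₂ c₂ ⟩
          k + (b₁ + b₂) + (c₁ + c₂)     ≡⟨ cong₂ (λ u v → k + u + v) b≡ c≡ ⟩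
          k + k + k                     ≡⟨ k+k+k≡3k k ⟩
          3 * k                         ∎))
    where
    open ≡-Reasoning
    content = content-rows₂ k b₁ c₁ 0 b₂ c₂
    ones = proj₁ content
    twos = proj₁ (proj₂ content)
    threes = proj₁ (proj₂ (proj₂ content))
    size≡ = proj₂ (proj₂ (proj₂ content))
    regroup : ∀ k b₁ c₁ b₂ c₂ → k + (b₁ + c₁) + (b₂ + c₂) ≡ k + (b₁ + b₂) + (c₁ + c₂)
    regroup = solve-∀

module _ {k a₁ b₁ c₁ a₂ b₂ c₂ a₃ b₃ c₃ : ℕ} where

  private
    r₁ = row a₁ b₁ c₁
    r₂ = row a₂ b₂ c₂
    r₃ = row a₃ b₃ c₃

  valid₃⇒ : T (isSSYTkkk k (r₁ ∷ r₂ ∷ r₃ ∷ [])) → Valid₃ k a₁ b₁ c₁ a₂ b₂ c₂ a₃ b₃ c₃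
  valid₃⇒ p
    with (rows , cols) , n₁ , n₂ , n₃ , _ ← Equivalence.to (isSSYTkkk⇔ k (r₁ ∷ r₂ ∷ r₃ ∷ [])) p
    with below₁₂ , cols₂₃ ← Equivalence.to (colsOK-∷∷⇔ r₁ r₂ (r₃ ∷ [])) cols
    with refl , b₂≤a₁ , b₂+c₂≤ ← strictBelow-row⇒ a₁ b₁ c₁ a₂ b₂ c₂ below₁₂
    with refl , z≤n , c₃≤b₂ ← strictBelow-row⇒ 0 b₂ c₂ a₃ b₃ c₃ (proj₁ (Equivalence.to (colsOK-∷∷⇔ r₂ r₃ []) cols₂₃))
    = let ones , twos , threes , _ = content-rows₃ a₁ b₁ c₁ 0 b₂ c₂ 0 0 c₃ in record
    { a₁≡k        = trans (sym (+-identityʳ a₁)) (trans (sym ones) n₁)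
    ; a₂≡0        = refl
    ; a₃≡0        = refl
    ; b₃≡0        = refl
    ; b₁+b₂≡k     = trans (cong (b₁ +_) (sym (+-identityʳ b₂))) (trans (sym twos) n₂)
    ; c₁+c₂+c₃≡k  = trans (sym threes) n₃
    ; b₂≤a₁       = b₂≤a₁
    ; b₂+c₂≤a₁+b₁ = b₂+c₂≤
    ; c₃≤b₂       = c₃≤b₂
    ; row₃≢[]     = proj₁ (Equivalence.to (rowsOK-row∷⇔ 0 0 c₃ []) rows₃)
    }
    where
    rows₃ = proj₂ (Equivalence.to (rowsOK-row∷⇔ 0 b₂ c₂ (r₃ ∷ []))
                    (proj₂ (Equivalence.to (rowsOK-row∷⇔ a₁ b₁ c₁ (r₂ ∷ r₃ ∷ [])) rows)))

  valid₃⇐ : 0 < k → Valid₃ k a₁ b₁ c₁ a₂ b₂ c₂ a₃ b₃ c₃ → T (isSSYTkkk k (r₁ ∷ r₂ ∷ r₃ ∷ []))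
  valid₃⇐ 0<k record { a₁≡k = refl ; a₂≡0 = refl ; a₃≡0 = refl ; b₃≡0 = refl ; b₁+b₂≡k = b≡ ; c₁+c₂+c₃≡k = c≡
                     ; b₂≤a₁ = b₂≤a₁ ; b₂+c₂≤a₁+b₁ = b₂+c₂≤ ; c₃≤b₂ = c₃≤b₂ ; row₃≢[] = row₃≢[] } =
    Equivalence.from (isSSYTkkk⇔ k (r₁ ∷ r₂ ∷ r₃ ∷ []))
      ( ( Equivalence.from (rowsOK-row∷⇔ k b₁ c₁ (r₂ ∷ r₃ ∷ []))
            (≤-trans 0<k (m≤m+n k _) , Equivalence.from (rowsOK-row∷⇔ 0 b₂ c₂ (r₃ ∷ []))
              (≤-trans (≤-trans row₃≢[] c₃≤b₂) (m≤m+n b₂ c₂) , Equivalence.from (rowsOK-row∷⇔ 0 0 c₃ []) (row₃≢[] , tt)))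
        , Equivalence.from (colsOK-∷∷⇔ r₁ r₂ (r₃ ∷ []))
            ( strictBelow-row⇐ k b₁ c₁ b₂ c₂ b₂≤a₁ b₂+c₂≤
            , Equivalence.from (colsOK-∷∷⇔ r₂ r₃ []) (strictBelow-row⇐ 0 b₂ c₂ 0 c₃ z≤n c₃≤b₂ , tt)) )
      , trans ones (+-identityʳ k) , trans twos (trans (cong (b₁ +_) (+-identityʳ b₂)) b≡) , trans threes c≡
      , (begin
          size (r₁ ∷ r₂ ∷ r₃ ∷ [])               ≡⟨ size≡ ⟩
          k + (b₁ + c₁) + ((b₂ + c₂) + c₃)       ≡⟨ regroup k b₁ c₁ b₂ c₂ c₃ ⟩
          k + (b₁ + b₂) + (c₁ + (c₂ + c₃))       ≡⟨ cong₂ (λ u v → k + u + v) b≡ c≡ ⟩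
          k + k + k                              ≡⟨ k+k+k≡3k k ⟩
          3 * k                                  ∎))
    where
    open ≡-Reasoning
    content = content-rows₃ k b₁ c₁ 0 b₂ c₂ 0 0 c₃
    ones = proj₁ content
    twos = proj₁ (proj₂ content)
    threes = proj₁ (proj₂ (proj₂ content))
    size≡ = proj₂ (proj₂ (proj₂ content))
    regroup : ∀ k b₁ c₁ b₂ c₂ c₃ → k + (b₁ + c₁) + ((b₂ + c₂) + c₃) ≡ k + (b₁ + b₂) + (c₁ + (c₂ + c₃))
    regroup = solve-∀

even≡isEven : ∀ n → even n ≡ isEven n
even≡isEven zero                = refl
even≡isEven (suc zero)          = refl
even≡isEven (suc (suc n))       = begin
  even (suc (suc n))            ≡⟨ cong (λ m → m % 2 ≡ᵇ 0) (+-comm 2 n) ⟩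
  ((n + 2) % 2 ≡ᵇ 0)            ≡⟨ cong (_≡ᵇ 0) ([m+n]%n≡m%n n 2) ⟩
  even n                        ≡⟨ even≡isEven n ⟩
  isEven n                      ≡⟨ sym (not-involutive (isEven n)) ⟩
  isEven (suc (suc n))          ∎
  where open ≡-Reasoning

twoRowTypeOf : ℕ → ℕ → Std3
twoRowTypeOf n₂ n₃ = if big n₂ n₃ then (if even n₂ then Ta else Td) else (if even n₂ then Tb else Tc)

-- The type of 1ᵏ 2ᵏ⁻ᵈ 3ᵏ⁻ᵉ⁻ᶠ / 2ᵈ 3ᵉ / 3ᶠ (rule (3) peels f columns); the clause for f > d = 0 is junk.
canonicalType : ℕ → ℕ → ℕ → Std3
canonicalType d       e zero    = twoRowTypeOf d e
canonicalType zero    e (suc f) = Ta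
canonicalType (suc d) e (suc f) = canonicalType d e f ᵗ

type-1row : ∀ k {a b c} → a ≡ k → b ≡ k → c ≡ k → type k (row a b c ∷ []) ≡ Ta
type-1row zero          refl refl refl = refl
type-1row (suc zero)    refl refl refl = refl
type-1row (suc (suc k)) refl refl refl = refl

type-2rows : ∀ k b c d e → b + d ≡ k → c + e ≡ k →
             type k (row k b c ∷ row 0 d e ∷ []) ≡ twoRowTypeOf d e
type-2rows (suc zero) zero       zero       (suc zero) (suc zero) refl refl = refl
type-2rows (suc zero) zero       (suc zero) (suc zero) zero       refl refl = refl
type-2rows (suc zero) (suc zero) zero       zero       (suc zero) refl refl = refl
type-2rows (suc zero) (suc zero) (suc zero) zero       zero       refl refl = refl
type-2rows zero          b c d e _ _ = cong₂ twoRowTypeOf (count₂-row 0 d e) (count₃-row 0 d e)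
type-2rows (suc (suc k)) b c d e _ _ = cong₂ twoRowTypeOf (count₂-row 0 d e) (count₃-row 0 d e)

private
  peel : ∀ m n {j} → m + suc n ≡ suc j → m + n ≡ j
  peel m n eq = suc-injective (trans (sym (+-suc m n)) eq)

  peel₂ : ∀ c e f {j} → c + (e + suc f) ≡ suc j → c + (e + f) ≡ j
  peel₂ c e f eq = peel c (e + f) (trans (cong (c +_) (sym (+-suc e f))) eq)

type-3rows : ∀ k b c d e f → b + d ≡ k → c + (e + f) ≡ k → 0 < f → f ≤ d →
             type k (row k b c ∷ row 0 d e ∷ row 0 0 f ∷ []) ≡ canonicalType d e f
type-3rows zero b c (suc d) e (suc f) b+d≡ _ _ _ = ⊥-elim (1+n≢0 (trans (sym (+-suc b d)) b+d≡))
type-3rows (suc zero) b c (suc d) e (suc f) b+d≡ c+e+f≡ _ (s≤s f≤d)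
  with refl ← m+n≡0⇒m≡0 b (peel b d b+d≡) | refl ← m+n≡0⇒n≡0 b (peel b d b+d≡) | z≤n ← f≤d
  with refl ← m+n≡0⇒m≡0 c (peel₂ c e 0 c+e+f≡) | refl ← m+n≡0⇒m≡0 e (m+n≡0⇒n≡0 c (peel₂ c e 0 c+e+f≡))
  = refl
type-3rows (suc (suc k)) b c (suc d) e (suc zero) b+d≡ c+e+f≡ _ _ =
  cong _ᵗ (first-column-removed d e (peel b d b+d≡) (trans (cong (c +_) (sym (+-identityʳ e))) (peel₂ c e 0 c+e+f≡)))
  where
  first-column-removed : ∀ d e → b + d ≡ suc k → c + e ≡ suc k →
    type (suc k) (removeFirstCol (row (suc (suc k)) b c ∷ row 0 (suc d) e ∷ row 0 0 1 ∷ [])) ≡ canonicalType d e 0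
  first-column-removed zero    zero    b≡ c≡ =
    type-1row (suc k) refl (trans (sym (+-identityʳ b)) b≡) (trans (sym (+-identityʳ c)) c≡)
  first-column-removed (suc d) e       b≡ c≡ = type-2rows (suc k) b c (suc d) e b≡ c≡
  first-column-removed zero    (suc e) b≡ c≡ = type-2rows (suc k) b c zero (suc e) b≡ c≡
type-3rows (suc (suc k)) b c (suc (suc d)) e (suc (suc f)) b+d≡ c+e+f≡ _ (s≤s f≤d) =
  cong _ᵗ (type-3rows (suc k) b c (suc d) e (suc f) (peel b (suc d) b+d≡) (peel₂ c e (suc f) c+e+f≡) (s≤s z≤n) f≤d)

data Hook : Std3 → Set where
  hookB : Hook Tb
  hookC : Hook Tc

parity : ∀ {t} → Hook t → ℕ → Bool
parity hookB d = isEven d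
parity hookC d = not (isEven d)

transposeHook : ∀ {t} → Hook t → Hook (t ᵗ)
transposeHook hookB = hookC
transposeHook hookC = hookB

parity-transposeHook : ∀ {t} (h : Hook t) d → parity (transposeHook h) d ≡ parity h (suc d)
parity-transposeHook hookB d = refl
parity-transposeHook hookC d = sym (not-involutive (isEven d))

ᵗ-≟ᵇ : ∀ {t} → Hook t → ∀ X → ((X ᵗ) ≟ᵇ t) ≡ (X ≟ᵇ (t ᵗ))
ᵗ-≟ᵇ hookB Ta = refl
ᵗ-≟ᵇ hookB Tb = refl
ᵗ-≟ᵇ hookB Tc = refl
ᵗ-≟ᵇ hookB Td = refl
ᵗ-≟ᵇ hookC Ta = refl
ᵗ-≟ᵇ hookC Tb = refl
ᵗ-≟ᵇ hookC Tc = refl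
ᵗ-≟ᵇ hookC Td = refl

twoRowTypeOf-≟ᵇ : ∀ {t} (h : Hook t) d e → (twoRowTypeOf d e ≟ᵇ t) ≡ not (big d e) ∧ parity h d
twoRowTypeOf-≟ᵇ hookB d e rewrite even≡isEven d with big d e | isEven d
... | true  | true  = refl
... | true  | false = refl
... | false | true  = refl
... | false | false = refl
twoRowTypeOf-≟ᵇ hookC d e rewrite even≡isEven d with big d e | isEven d
... | true  | true  = refl
... | true  | false = refl
... | false | true  = refl
... | false | false = refl

canonicalType-≟ᵇ : ∀ {t} (h : Hook t) d e f → f ≤ d →
                   (canonicalType d e f ≟ᵇ t) ≡ not (big (d ∸ f) e) ∧ parity h d
canonicalType-≟ᵇ h d       e zero    _         = twoRowTypeOf-≟ᵇ h d e
canonicalType-≟ᵇ h (suc d) e (suc f) (s≤s f≤d) = begin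
  ((canonicalType d e f ᵗ) ≟ᵇ _)                       ≡⟨ ᵗ-≟ᵇ h (canonicalType d e f) ⟩
  (canonicalType d e f ≟ᵇ (_ ᵗ))                       ≡⟨ canonicalType-≟ᵇ (transposeHook h) d e f f≤d ⟩
  not (big (d ∸ f) e) ∧ parity (transposeHook h) d     ≡⟨ cong (not (big (d ∸ f) e) ∧_) (parity-transposeHook h d) ⟩
  not (big (d ∸ f) e) ∧ parity h (suc d)               ∎
  where open ≡-Reasoning

hook-split : ∀ {t} (hk : Hook t) v {X d e f} → (T v → X ≡ canonicalType d e f × f ≤ d) →
             v ∧ (X ≟ᵇ t) ≡ (v ∧ not (big (d ∸ f) e)) ∧ parity hk d
hook-split {t} hk v {X} {d} {e} {f} typed = trans
  (∧-congˡ-T v λ p → let X≡ , f≤d = typed p in trans (cong (_≟ᵇ t) X≡) (canonicalType-≟ᵇ hk d e f f≤d))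
  (sym (∧-assoc v _ _))

-- Tableaux of a given shape

_≟ₗ_ : DecidableEquality (List ℕ)
_≟ₗ_ = ≡-dec _≟_

ofShape : ℕ → List ℕ → Tableau → Bool
ofShape k z S = isSSYTkkk k S ∧ does (z ≟ₗ shape S)

ofShape⇔ : ∀ k z S → T (ofShape k z S) ⇔ (T (isSSYTkkk k S) × shape S ≡ z)
ofShape⇔ k z S with z ≟ₗ shape S
... | yes z≡ = mk⇔ (λ p → proj₁ (T-∧⁻ (isSSYTkkk k S) p) , sym z≡) (λ (v , _) → T-∧⁺ (isSSYTkkk k S) v _)
... | no  z≢ = mk⇔ (λ p → ⊥-elim (proj₂ (T-∧⁻ (isSSYTkkk k S) p))) (λ (_ , s) → ⊥-elim (z≢ (sym s)))

canonical₂ : ℕ → ℕ → ℕ → Tableau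
canonical₂ k y d = row k (k ∸ d) (k ∸ (y ∸ d)) ∷ row 0 d (y ∸ d) ∷ []

canonical₃ : ℕ → ℕ → ℕ → ℕ → Tableau
canonical₃ k y w d = row k (k ∸ d) (k ∸ (y ∸ d + w)) ∷ row 0 d (y ∸ d) ∷ row 0 0 w ∷ []

private
  m∸n+n≡m⇒n≤m : ∀ {k d} → k ∸ d + d ≡ k → d ≤ k
  m∸n+n≡m⇒n≤m {k} {d} eq = subst (d ≤_) eq (m≤n+m d (k ∸ d))

  row-lengths-sum : ∀ k d e w c → k ∸ d + d ≡ k → c + (e + w) ≡ k →
               k + ((k ∸ d) + c) + (d + e) + w ≡ 3 * k
  row-lengths-sum k d e w c b≡ c≡ = begin
    k + ((k ∸ d) + c) + (d + e) + w      ≡⟨ regroup k (k ∸ d) c d e w ⟩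
    k + ((k ∸ d) + d) + (c + (e + w))    ≡⟨ cong₂ (λ u v → k + u + v) b≡ c≡ ⟩
    k + k + k                            ≡⟨ k+k+k≡3k k ⟩
    3 * k                                ∎
    where
    open ≡-Reasoning
    regroup : ∀ k b c d e w → k + (b + c) + (d + e) + w ≡ k + (b + d) + (c + (e + w))
    regroup = solve-∀

  y+d≤k+k : ∀ {k d y} → d ≤ k → y ≤ k + (k ∸ d) → y + d ≤ k + k
  y+d≤k+k {k} {d} {y} d≤k y≤ = ≤-trans (+-monoˡ-≤ d y≤)
    (≤-reflexive (trans (+-assoc k (k ∸ d) d) (cong (k +_) (m∸n+n≡m d≤k))))

  d+[y∸d]≤k+[k∸d] : ∀ {k d y} → d ≤ k → d ≤ y → y + d ≤ k + k → d + (y ∸ d) ≤ k + (k ∸ d)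
  d+[y∸d]≤k+[k∸d] {k} {d} {y} d≤k d≤y le = +-cancelʳ-≤ d _ _
    (subst₂ _≤_ (cong (_+ d) (sym (m+[n∸m]≡n d≤y))) (sym (trans (+-assoc k (k ∸ d) d) (cong (k +_) (m∸n+n≡m d≤k)))) le)

module _ {k x y w d : ℕ} where

  private
    e = y ∸ d
    c = k ∸ (e + w)
    S = canonical₃ k y w d

  shape-canonical₃ : shape S ≡ (k + ((k ∸ d) + c)) ∷ (d + e) ∷ w ∷ []
  shape-canonical₃ =
    cong₂ _∷_ (length-row k (k ∸ d) c) (cong₂ _∷_ (length-row 0 d e) (cong (_∷ []) (length-row 0 0 w)))

  canonical₃⇒ : T (isSSYTkkk k S) → shape S ≡ x ∷ y ∷ w ∷ [] →
                (x + y + w ≡ 3 * k × 0 < w) × Legal k d y w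
  canonical₃⇒ valid shape≡ =
    (trans (cong₂ (λ u v → u + v + w) x≡ y≡) (row-lengths-sum k d e w c b₁+b₂≡k c₁+c₂+c₃≡k) , row₃≢[]) ,
    record
      { f≤d     = c₃≤b₂
      ; d≤m     = subst (d ≤_) (sym y≡) (m≤m+n d e)
      ; m+f≤k+d = begin
          y + w         ≡⟨ cong (_+ w) y≡ ⟩
          d + e + w     ≡⟨ +-assoc d e w ⟩
          d + (e + w)   ≤⟨ +-monoʳ-≤ d (subst (e + w ≤_) c₁+c₂+c₃≡k (m≤n+m (e + w) c)) ⟩
          d + k         ≡⟨ +-comm d k ⟩
          k + d         ∎
      ; m+d≤k+k = y+d≤k+k d≤k (subst (_≤ k + (k ∸ d)) (sym y≡) b₂+c₂≤a₁+b₁)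
      ; d≤k     = d≤k
      }
    where
    open ≤-Reasoning
    open Valid₃ (valid₃⇒ {k} {k} {k ∸ d} {c} {0} {d} {e} {0} {0} {w} valid)
    eqs = trans (sym shape≡) shape-canonical₃
    x≡ : x ≡ k + ((k ∸ d) + c)
    x≡ = ∷-injectiveˡ eqs
    y≡ : y ≡ d + e
    y≡ = ∷-injectiveˡ (∷-injectiveʳ eqs)
    d≤k = m∸n+n≡m⇒n≤m b₁+b₂≡k

  canonical₃⇐ : 0 < k → (x + y + w ≡ 3 * k × 0 < w) × Legal k d y w →
                T (isSSYTkkk k S) × shape S ≡ x ∷ y ∷ w ∷ []
  canonical₃⇐ 0<k ((sum≡ , 0<w) , L) =
    valid₃⇐ {k} {k} {k ∸ d} {c} {0} {d} {e} {0} {0} {w} 0<k (record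
      { a₁≡k = refl ; a₂≡0 = refl ; a₃≡0 = refl ; b₃≡0 = refl
      ; b₁+b₂≡k     = m∸n+n≡m d≤k
      ; c₁+c₂+c₃≡k  = m∸n+n≡m e+w≤k
      ; b₂≤a₁       = d≤k
      ; b₂+c₂≤a₁+b₁ = d+[y∸d]≤k+[k∸d] d≤k d≤m m+d≤k+k
      ; c₃≤b₂       = f≤d
      ; row₃≢[]     = 0<w
      }) ,
    trans shape-canonical₃ (cong₂ _∷_ (sym x≡) (cong (_∷ w ∷ []) d+e≡y))
    where
    open Legal L
    d+e≡y : d + e ≡ y
    d+e≡y = m+[n∸m]≡n d≤m
    e+w≤k : e + w ≤ k
    e+w≤k = +-cancelˡ-≤ d _ _ (begin
      d + (e + w)   ≡⟨ sym (+-assoc d e w) ⟩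
      d + e + w     ≡⟨ cong (_+ w) d+e≡y ⟩
      y + w         ≤⟨ m+f≤k+d ⟩
      k + d         ≡⟨ +-comm k d ⟩
      d + k         ∎)
      where open ≤-Reasoning
    x≡ : x ≡ k + ((k ∸ d) + c)
    x≡ = +-cancelʳ-≡ (y + w) _ _ (begin
      x + (y + w)                           ≡⟨ sym (+-assoc x y w) ⟩
      x + y + w                             ≡⟨ sum≡ ⟩
      3 * k                                 ≡⟨ sym (row-lengths-sum k d e w c (m∸n+n≡m d≤k) (m∸n+n≡m e+w≤k)) ⟩
      k + ((k ∸ d) + c) + (d + e) + w       ≡⟨ +-assoc (k + ((k ∸ d) + c)) (d + e) w ⟩
      k + ((k ∸ d) + c) + (d + e + w)       ≡⟨ cong (λ u → k + ((k ∸ d) + c) + (u + w)) d+e≡y ⟩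
      k + ((k ∸ d) + c) + (y + w)           ∎)
      where open ≡-Reasoning

module _ {k x y d : ℕ} where

  private
    e = y ∸ d
    c = k ∸ e
    S = canonical₂ k y d

  shape-canonical₂ : shape S ≡ (k + ((k ∸ d) + c)) ∷ (d + e) ∷ []
  shape-canonical₂ = cong₂ _∷_ (length-row k (k ∸ d) c) (cong (_∷ []) (length-row 0 d e))

  canonical₂⇒ : T (isSSYTkkk k S) → shape S ≡ x ∷ y ∷ [] → (x + y ≡ 3 * k × 0 < y) × Legal k d y 0
  canonical₂⇒ valid shape≡ =
    (sum≡ , subst (0 <_) (sym y≡) row₂≢[]) ,
    record
      { f≤d     = z≤n
      ; d≤m     = subst (d ≤_) (sym y≡) (m≤m+n d e)
      ; m+f≤k+d = begin
          y + 0         ≡⟨ +-identityʳ y ⟩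
          y             ≡⟨ y≡ ⟩
          d + e         ≤⟨ +-monoʳ-≤ d (subst (e ≤_) c₁+c₂≡k (m≤n+m e c)) ⟩
          d + k         ≡⟨ +-comm d k ⟩
          k + d         ∎
      ; m+d≤k+k = y+d≤k+k d≤k (subst (_≤ k + (k ∸ d)) (sym y≡) b₂+c₂≤a₁+b₁)
      ; d≤k     = d≤k
      }
    where
    open ≤-Reasoning
    open Valid₂ (valid₂⇒ {k} {k} {k ∸ d} {c} {0} {d} {e} valid)
    eqs = trans (sym shape≡) shape-canonical₂
    y≡ : y ≡ d + e
    y≡ = ∷-injectiveˡ (∷-injectiveʳ eqs)
    d≤k = m∸n+n≡m⇒n≤m b₁+b₂≡k
    sum≡ : x + y ≡ 3 * k
    sum≡ = trans (cong₂ _+_ (∷-injectiveˡ eqs) y≡)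
      (trans (sym (+-identityʳ _)) (row-lengths-sum k d e 0 c b₁+b₂≡k (trans (cong (c +_) (+-identityʳ e)) c₁+c₂≡k)))

  canonical₂⇐ : 0 < k → (x + y ≡ 3 * k × 0 < y) × Legal k d y 0 →
                T (isSSYTkkk k S) × shape S ≡ x ∷ y ∷ []
  canonical₂⇐ 0<k ((sum≡ , 0<y) , L) =
    valid₂⇐ {k} {k} {k ∸ d} {c} {0} {d} {e} 0<k (record
      { a₁≡k = refl ; a₂≡0 = refl
      ; b₁+b₂≡k     = m∸n+n≡m d≤k
      ; c₁+c₂≡k     = m∸n+n≡m e≤k
      ; b₂≤a₁       = d≤k
      ; b₂+c₂≤a₁+b₁ = d+[y∸d]≤k+[k∸d] d≤k d≤m m+d≤k+k
      ; row₂≢[]     = subst (0 <_) (sym d+e≡y) 0<y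
      }) ,
    trans shape-canonical₂ (cong₂ _∷_ (sym x≡) (cong (_∷ []) d+e≡y))
    where
    open Legal L
    d+e≡y : d + e ≡ y
    d+e≡y = m+[n∸m]≡n d≤m
    e≤k : e ≤ k
    e≤k = +-cancelˡ-≤ d _ _ (begin
      d + e         ≡⟨ d+e≡y ⟩
      y             ≡⟨ sym (+-identityʳ y) ⟩
      y + 0         ≤⟨ m+f≤k+d ⟩
      k + d         ≡⟨ +-comm k d ⟩
      d + k         ∎)
      where open ≤-Reasoning
    c+e+0≡k : c + (e + 0) ≡ k
    c+e+0≡k = trans (cong (c +_) (+-identityʳ e)) (m∸n+n≡m e≤k)
    x≡ : x ≡ k + ((k ∸ d) + c)
    x≡ = +-cancelʳ-≡ y _ _ (begin
      x + y                                 ≡⟨ sum≡ ⟩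
      3 * k                                 ≡⟨ sym (row-lengths-sum k d e 0 c (m∸n+n≡m d≤k) c+e+0≡k) ⟩
      k + ((k ∸ d) + c) + (d + e) + 0       ≡⟨ +-identityʳ _ ⟩
      k + ((k ∸ d) + c) + (d + e)           ≡⟨ cong (k + ((k ∸ d) + c) +_) d+e≡y ⟩
      k + ((k ∸ d) + c) + y                 ∎)
      where open ≡-Reasoning

module _ {k y d : ℕ} where

  type-canonical₂ : T (isSSYTkkk k (canonical₂ k y d)) →
                    type k (canonical₂ k y d) ≡ canonicalType d (y ∸ d) 0 × 0 ≤ d
  type-canonical₂ valid = type-2rows k (k ∸ d) (k ∸ (y ∸ d)) d (y ∸ d) b₁+b₂≡k c₁+c₂≡k , z≤n
    where open Valid₂ (valid₂⇒ {k} {k} {k ∸ d} {k ∸ (y ∸ d)} {0} {d} {y ∸ d} valid)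

  ofShape-canonical₂⇔ : ∀ {x} → 0 < k →
                        T (ofShape k (x ∷ y ∷ []) (canonical₂ k y d)) ⇔ ((x + y ≡ 3 * k × 0 < y) × Legal k d y 0)
  ofShape-canonical₂⇔ {x} 0<k = mk⇔
    (λ p → let v , s = Equivalence.to (ofShape⇔ k _ (canonical₂ k y d)) p in canonical₂⇒ v s)
    (λ q → Equivalence.from (ofShape⇔ k _ (canonical₂ k y d)) (canonical₂⇐ 0<k q))

module _ {k y w d : ℕ} where

  type-canonical₃ : T (isSSYTkkk k (canonical₃ k y w d)) →
                    type k (canonical₃ k y w d) ≡ canonicalType d (y ∸ d) w × w ≤ d
  type-canonical₃ valid = type-3rows k (k ∸ d) (k ∸ (y ∸ d + w)) d (y ∸ d) w b₁+b₂≡k c₁+c₂+c₃≡k row₃≢[] c₃≤b₂ , c₃≤b₂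
    where open Valid₃ (valid₃⇒ {k} {k} {k ∸ d} {k ∸ (y ∸ d + w)} {0} {d} {y ∸ d} {0} {0} {w} valid)

  ofShape-canonical₃⇔ : ∀ {x} → 0 < k →
                        T (ofShape k (x ∷ y ∷ w ∷ []) (canonical₃ k y w d)) ⇔ ((x + y + w ≡ 3 * k × 0 < w) × Legal k d y w)
  ofShape-canonical₃⇔ {x} 0<k = mk⇔
    (λ p → let v , s = Equivalence.to (ofShape⇔ k _ (canonical₃ k y w d)) p in canonical₃⇒ v s)
    (λ q → Equivalence.from (ofShape⇔ k _ (canonical₃ k y w d)) (canonical₃⇐ 0<k q))

-- Sums over the candidate tableaux

∑-candRows : ∀ k G → ∑ G (candRows k) ≡ ∑³ (suc k) (λ a b c → G (row a b c))
∑-candRows k G =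
  trans (∑-concatMap G byA U) (trans (∑-applyUpTo (∑ G ∘ byA) id n) (∑<-cong n λ a _ →
  trans (∑-concatMap G (byAB a) U) (trans (∑-applyUpTo (∑ G ∘ byAB a) id n) (∑<-cong n λ b _ →
  trans (∑-map G (row a b) U) (∑-applyUpTo (G ∘ row a b) id n)))))
  where
  n = suc k
  U = upTo n
  byAB : ℕ → ℕ → List (List ℕ)
  byAB a b = map (row a b) U
  byA : ℕ → List (List ℕ)
  byA a = concatMap (byAB a) U

module _ {A : Set} (k : ℕ) where

  ∑-map-candRows : ∀ (f : List ℕ → A) G → ∑ G (map f (candRows k)) ≡ ∑³ (suc k) (λ a b c → G (f (row a b c)))
  ∑-map-candRows f G = trans (∑-map G f (candRows k)) (∑-candRows k (G ∘ f))

  ∑-concatMap-candRows : ∀ (f : List ℕ → List A) G →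
                         ∑ G (concatMap f (candRows k)) ≡ ∑³ (suc k) (λ a b c → ∑ G (f (row a b c)))
  ∑-concatMap-candRows f G = trans (∑-concatMap G f (candRows k)) (∑-candRows k (∑ G ∘ f))

∑rows₁ ∑rows₂ ∑rows₃ : ℕ → (Tableau → ℕ) → ℕ
∑rows₁ n F = ∑³ n (λ a b c → F (row a b c ∷ []))
∑rows₂ n F = ∑³ n (λ a₁ b₁ c₁ → ∑³ n (λ a₂ b₂ c₂ → F (row a₁ b₁ c₁ ∷ row a₂ b₂ c₂ ∷ [])))
∑rows₃ n F = ∑³ n (λ a₁ b₁ c₁ → ∑³ n (λ a₂ b₂ c₂ → ∑³ n (λ a₃ b₃ c₃ →
               F (row a₁ b₁ c₁ ∷ row a₂ b₂ c₂ ∷ row a₃ b₃ c₃ ∷ []))))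

∑-candidates : ∀ k F → ∑ F (candidates k) ≡ F [] + (∑rows₁ (suc k) F + (∑rows₂ (suc k) F + ∑rows₃ (suc k) F))
∑-candidates k F =
  cong (F [] +_) (trans (∑-++ F one (two ++ three)) (cong₂ _+_ ∑-one (trans (∑-++ F two three) (cong₂ _+_ ∑-two ∑-three))))
  where
  n = suc k
  R = candRows k
  pairs : List ℕ → List Tableau
  pairs r₁ = map (λ r₂ → r₁ ∷ r₂ ∷ []) R
  triples : List ℕ → List ℕ → List Tableau
  triples r₁ r₂ = map (λ r₃ → r₁ ∷ r₂ ∷ r₃ ∷ []) R
  one = map (_∷ []) R
  two = concatMap pairs R
  three = concatMap (λ r₁ → concatMap (triples r₁) R) R
  ∑-one : ∑ F one ≡ ∑rows₁ n F
  ∑-one = ∑-map-candRows k (_∷ []) F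
  ∑-two : ∑ F two ≡ ∑rows₂ n F
  ∑-two = trans (∑-concatMap-candRows k pairs F) (∑³-cong n λ a₁ b₁ c₁ →
            ∑-map-candRows k (λ r₂ → row a₁ b₁ c₁ ∷ r₂ ∷ []) F)
  ∑-three : ∑ F three ≡ ∑rows₃ n F
  ∑-three = trans (∑-concatMap-candRows k (λ r₁ → concatMap (triples r₁) R) F) (∑³-cong n λ a₁ b₁ c₁ →
              trans (∑-concatMap-candRows k (triples (row a₁ b₁ c₁)) F) (∑³-cong n λ a₂ b₂ c₂ →
                ∑-map-candRows k (λ r₃ → row a₁ b₁ c₁ ∷ row a₂ b₂ c₂ ∷ r₃ ∷ []) F))

module _ (k y w x : ℕ) (F : Tableau → ℕ)
         (supported : ∀ S → F S ≢ 0 → T (ofShape k (x ∷ y ∷ w ∷ []) S)) where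

  private
    n = suc k

    forcedRow₃ : List ℕ
    forcedRow₃ = row 0 0 w

    forcedRow₂ : ℕ → List ℕ
    forcedRow₂ b₁ = row 0 (k ∸ b₁) (y ∸ (k ∸ b₁))

    forcedC₁ : ℕ → ℕ
    forcedC₁ b₁ = k ∸ (y ∸ (k ∸ b₁) + w)

    support : ∀ a₁ b₁ c₁ a₂ b₂ c₂ a₃ b₃ c₃ → F (row a₁ b₁ c₁ ∷ row a₂ b₂ c₂ ∷ row a₃ b₃ c₃ ∷ []) ≢ 0 →
              Valid₃ k a₁ b₁ c₁ a₂ b₂ c₂ a₃ b₃ c₃ × a₂ + (b₂ + c₂) ≡ y × a₃ + (b₃ + c₃) ≡ w
    support a₁ b₁ c₁ a₂ b₂ c₂ a₃ b₃ c₃ ne =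
      valid₃⇒ valid , ∷-injectiveˡ (∷-injectiveʳ lengths) , ∷-injectiveˡ (∷-injectiveʳ (∷-injectiveʳ lengths))
      where
      S = row a₁ b₁ c₁ ∷ row a₂ b₂ c₂ ∷ row a₃ b₃ c₃ ∷ []
      valid = proj₁ (Equivalence.to (ofShape⇔ k (x ∷ y ∷ w ∷ []) S) (supported S ne))
      lengths : a₁ + (b₁ + c₁) ∷ a₂ + (b₂ + c₂) ∷ a₃ + (b₃ + c₃) ∷ [] ≡ x ∷ y ∷ w ∷ []
      lengths = trans (sym (cong₂ _∷_ (length-row a₁ b₁ c₁)
                                      (cong₂ _∷_ (length-row a₂ b₂ c₂) (cong (_∷ []) (length-row a₃ b₃ c₃)))))
                      (proj₂ (Equivalence.to (ofShape⇔ k (x ∷ y ∷ w ∷ []) S) (supported S ne)))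

    third-row : ∀ a₁ b₁ c₁ a₂ b₂ c₂ →
      ∑³ n (λ a₃ b₃ c₃ → F (row a₁ b₁ c₁ ∷ row a₂ b₂ c₂ ∷ row a₃ b₃ c₃ ∷ []))
        ≡ F (row a₁ b₁ c₁ ∷ row a₂ b₂ c₂ ∷ forcedRow₃ ∷ [])
    third-row a₁ b₁ c₁ a₂ b₂ c₂ = ∑³-single n 0 0 w forced
      where
      forced : ∀ a₃ b₃ c₃ → F (row a₁ b₁ c₁ ∷ row a₂ b₂ c₂ ∷ row a₃ b₃ c₃ ∷ []) ≢ 0 →
               (a₃ ≡ 0 × b₃ ≡ 0 × c₃ ≡ w) × (a₃ < n × b₃ < n × c₃ < n)
      forced a₃ b₃ c₃ ne with record { a₃≡0 = refl ; b₃≡0 = refl ; c₁+c₂+c₃≡k = c≡k } , _ , w≡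
                                ← support a₁ b₁ c₁ a₂ b₂ c₂ a₃ b₃ c₃ ne =
        (refl , refl , w≡) , (z<s , z<s , s≤s (≤-trans (m≤n+m c₃ c₂) (≤-trans (m≤n+m _ c₁) (≤-reflexive c≡k))))

    second-row : ∀ a₁ b₁ c₁ →
      ∑³ n (λ a₂ b₂ c₂ → F (row a₁ b₁ c₁ ∷ row a₂ b₂ c₂ ∷ forcedRow₃ ∷ []))
        ≡ F (row a₁ b₁ c₁ ∷ forcedRow₂ b₁ ∷ forcedRow₃ ∷ [])
    second-row a₁ b₁ c₁ = ∑³-single n 0 (k ∸ b₁) (y ∸ (k ∸ b₁)) forced
      where
      forced : ∀ a₂ b₂ c₂ → F (row a₁ b₁ c₁ ∷ row a₂ b₂ c₂ ∷ forcedRow₃ ∷ []) ≢ 0 →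
               (a₂ ≡ 0 × b₂ ≡ k ∸ b₁ × c₂ ≡ y ∸ (k ∸ b₁)) × (a₂ < n × b₂ < n × c₂ < n)
      forced a₂ b₂ c₂ ne with record { a₂≡0 = refl ; b₁+b₂≡k = refl ; c₁+c₂+c₃≡k = c≡k } , y≡ , _
                                ← support a₁ b₁ c₁ a₂ b₂ c₂ 0 0 w ne =
        (refl , sym (m+n∸m≡n b₁ b₂) , trans (sym (m+n∸m≡n b₂ c₂)) (cong₂ _∸_ y≡ (sym (m+n∸m≡n b₁ b₂)))) ,
        (z<s , s≤s (m≤n+m b₂ b₁) , s≤s (≤-trans (m≤m+n c₂ w) (≤-trans (m≤n+m _ c₁) (≤-reflexive c≡k))))

    first-row : ∑³ n (λ a₁ b₁ c₁ → F (row a₁ b₁ c₁ ∷ forcedRow₂ b₁ ∷ forcedRow₃ ∷ []))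
              ≡ ∑< n (λ b₁ → F (row k b₁ (forcedC₁ b₁) ∷ forcedRow₂ b₁ ∷ forcedRow₃ ∷ []))
    first-row = ∑³-line n k forcedC₁ forced
      where
      forced : ∀ a₁ b₁ c₁ → F (row a₁ b₁ c₁ ∷ forcedRow₂ b₁ ∷ forcedRow₃ ∷ []) ≢ 0 →
               (a₁ ≡ k × c₁ ≡ forcedC₁ b₁) × (a₁ < n × c₁ < n)
      forced a₁ b₁ c₁ ne with record { a₁≡k = refl ; c₁+c₂+c₃≡k = c≡k } , _
                                ← support a₁ b₁ c₁ 0 (k ∸ b₁) (y ∸ (k ∸ b₁)) 0 0 w ne =
        (refl , trans (sym (m+n∸n≡m c₁ (y ∸ (k ∸ b₁) + w))) (cong (_∸ (y ∸ (k ∸ b₁) + w)) c≡k)) ,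
        (≤-refl , s≤s (≤-trans (m≤m+n c₁ _) (≤-reflexive c≡k)))

    reflected : ∀ b₁ → b₁ < n →
      F (row k b₁ (forcedC₁ b₁) ∷ forcedRow₂ b₁ ∷ forcedRow₃ ∷ []) ≡ F (canonical₃ k y w (k ∸ b₁))
    reflected b₁ b₁<n =
      cong (λ b → F (row k b (forcedC₁ b₁) ∷ forcedRow₂ b₁ ∷ forcedRow₃ ∷ [])) (sym (m∸[m∸n]≡n (s≤s⁻¹ b₁<n)))

  ∑rows₃-canonical : ∑rows₃ n F ≡ ∑< n (λ d → F (canonical₃ k y w d))
  ∑rows₃-canonical = begin
    ∑rows₃ n F
      ≡⟨ ∑³-cong n (λ a₁ b₁ c₁ → trans (∑³-cong n (third-row a₁ b₁ c₁)) (second-row a₁ b₁ c₁)) ⟩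
    ∑³ n (λ a₁ b₁ c₁ → F (row a₁ b₁ c₁ ∷ forcedRow₂ b₁ ∷ forcedRow₃ ∷ []))
      ≡⟨ first-row ⟩
    ∑< n (λ b₁ → F (row k b₁ (forcedC₁ b₁) ∷ forcedRow₂ b₁ ∷ forcedRow₃ ∷ []))
      ≡⟨ ∑<-cong n reflected ⟩
    ∑< n (λ b₁ → F (canonical₃ k y w (k ∸ b₁)))
      ≡⟨ ∑<-reflect k (λ d → F (canonical₃ k y w d)) ⟩
    ∑< n (λ d → F (canonical₃ k y w d))
      ∎
    where open ≡-Reasoning

module _ (k y x : ℕ) (F : Tableau → ℕ)
         (supported : ∀ S → F S ≢ 0 → T (ofShape k (x ∷ y ∷ []) S)) where

  private
    n = suc k

    forcedRow₂ : ℕ → List ℕ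
    forcedRow₂ b₁ = row 0 (k ∸ b₁) (y ∸ (k ∸ b₁))

    forcedC₁ : ℕ → ℕ
    forcedC₁ b₁ = k ∸ (y ∸ (k ∸ b₁))

    support : ∀ a₁ b₁ c₁ a₂ b₂ c₂ → F (row a₁ b₁ c₁ ∷ row a₂ b₂ c₂ ∷ []) ≢ 0 →
              Valid₂ k a₁ b₁ c₁ a₂ b₂ c₂ × a₂ + (b₂ + c₂) ≡ y
    support a₁ b₁ c₁ a₂ b₂ c₂ ne = valid₂⇒ valid , ∷-injectiveˡ (∷-injectiveʳ lengths)
      where
      S = row a₁ b₁ c₁ ∷ row a₂ b₂ c₂ ∷ []
      valid = proj₁ (Equivalence.to (ofShape⇔ k (x ∷ y ∷ []) S) (supported S ne))
      lengths : a₁ + (b₁ + c₁) ∷ a₂ + (b₂ + c₂) ∷ [] ≡ x ∷ y ∷ []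
      lengths = trans (sym (cong₂ _∷_ (length-row a₁ b₁ c₁) (cong (_∷ []) (length-row a₂ b₂ c₂))))
                      (proj₂ (Equivalence.to (ofShape⇔ k (x ∷ y ∷ []) S) (supported S ne)))

    second-row : ∀ a₁ b₁ c₁ →
      ∑³ n (λ a₂ b₂ c₂ → F (row a₁ b₁ c₁ ∷ row a₂ b₂ c₂ ∷ [])) ≡ F (row a₁ b₁ c₁ ∷ forcedRow₂ b₁ ∷ [])
    second-row a₁ b₁ c₁ = ∑³-single n 0 (k ∸ b₁) (y ∸ (k ∸ b₁)) forced
      where
      forced : ∀ a₂ b₂ c₂ → F (row a₁ b₁ c₁ ∷ row a₂ b₂ c₂ ∷ []) ≢ 0 →
               (a₂ ≡ 0 × b₂ ≡ k ∸ b₁ × c₂ ≡ y ∸ (k ∸ b₁)) × (a₂ < n × b₂ < n × c₂ < n)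
      forced a₂ b₂ c₂ ne with record { a₂≡0 = refl ; b₁+b₂≡k = refl ; c₁+c₂≡k = c≡k } , y≡
                                ← support a₁ b₁ c₁ a₂ b₂ c₂ ne =
        (refl , sym (m+n∸m≡n b₁ b₂) , trans (sym (m+n∸m≡n b₂ c₂)) (cong₂ _∸_ y≡ (sym (m+n∸m≡n b₁ b₂)))) ,
        (z<s , s≤s (m≤n+m b₂ b₁) , s≤s (≤-trans (m≤n+m c₂ c₁) (≤-reflexive c≡k)))

    first-row : ∑³ n (λ a₁ b₁ c₁ → F (row a₁ b₁ c₁ ∷ forcedRow₂ b₁ ∷ []))
              ≡ ∑< n (λ b₁ → F (row k b₁ (forcedC₁ b₁) ∷ forcedRow₂ b₁ ∷ []))
    first-row = ∑³-line n k forcedC₁ forced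
      where
      forced : ∀ a₁ b₁ c₁ → F (row a₁ b₁ c₁ ∷ forcedRow₂ b₁ ∷ []) ≢ 0 →
               (a₁ ≡ k × c₁ ≡ forcedC₁ b₁) × (a₁ < n × c₁ < n)
      forced a₁ b₁ c₁ ne with record { a₁≡k = refl ; c₁+c₂≡k = c≡k } , _
                                ← support a₁ b₁ c₁ 0 (k ∸ b₁) (y ∸ (k ∸ b₁)) ne =
        (refl , trans (sym (m+n∸n≡m c₁ (y ∸ (k ∸ b₁)))) (cong (_∸ (y ∸ (k ∸ b₁))) c≡k)) ,
        (≤-refl , s≤s (≤-trans (m≤m+n c₁ _) (≤-reflexive c≡k)))

    reflected : ∀ b₁ → b₁ < n → F (row k b₁ (forcedC₁ b₁) ∷ forcedRow₂ b₁ ∷ []) ≡ F (canonical₂ k y (k ∸ b₁))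
    reflected b₁ b₁<n = cong (λ b → F (row k b (forcedC₁ b₁) ∷ forcedRow₂ b₁ ∷ [])) (sym (m∸[m∸n]≡n (s≤s⁻¹ b₁<n)))

  ∑rows₂-canonical : ∑rows₂ n F ≡ ∑< n (λ d → F (canonical₂ k y d))
  ∑rows₂-canonical = begin
    ∑rows₂ n F                                                    ≡⟨ ∑³-cong n second-row ⟩
    ∑³ n (λ a₁ b₁ c₁ → F (row a₁ b₁ c₁ ∷ forcedRow₂ b₁ ∷ []))       ≡⟨ first-row ⟩
    ∑< n (λ b₁ → F (row k b₁ (forcedC₁ b₁) ∷ forcedRow₂ b₁ ∷ []))   ≡⟨ ∑<-cong n reflected ⟩
    ∑< n (λ b₁ → F (canonical₂ k y (k ∸ b₁)))                      ≡⟨ ∑<-reflect k (λ d → F (canonical₂ k y d)) ⟩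
    ∑< n (λ d → F (canonical₂ k y d))                              ∎
    where open ≡-Reasoning

-- Counting shapes by type

hasShapeAndType : ℕ → List ℕ → Std3 → Tableau → Bool
hasShapeAndType k z t S = ofShape k z S ∧ (type k S ≟ᵇ t)

multiplicity-shapesOfType : ∀ k t z →
  multiplicity _≟ₗ_ z (shapesOfType k t) ≡ ∑ (λ S → 𝟙 (hasShapeAndType k z t S)) (candidates k)
multiplicity-shapesOfType k t z = begin
  multiplicity _≟ₗ_ z (shapesOfType k t)
    ≡⟨ ∑-map _ shape Lt ⟩
  ∑ (λ S → 𝟙 (does (z ≟ₗ shape S))) Lt
    ≡⟨ ∑-filterᵇ _ (λ S → type k S ≟ᵇ t) (SSYTkkk k) ⟩
  ∑ (λ S → if type k S ≟ᵇ t then 𝟙 (does (z ≟ₗ shape S)) else 0) (SSYTkkk k)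
    ≡⟨ ∑-filterᵇ _ (isSSYTkkk k) (candidates k) ⟩
  ∑ (λ S → if isSSYTkkk k S then (if type k S ≟ᵇ t then 𝟙 (does (z ≟ₗ shape S)) else 0) else 0) (candidates k)
    ≡⟨ ∑-cong (λ S → nested-if (isSSYTkkk k S) (type k S ≟ᵇ t) _) (candidates k) ⟩
  ∑ (λ S → 𝟙 (hasShapeAndType k z t S)) (candidates k)
    ∎
  where
  open ≡-Reasoning
  Lt = filterᵇ (λ S → type k S ≟ᵇ t) (SSYTkkk k)
  nested-if : ∀ a b c → (if a then (if b then 𝟙 c else 0) else 0) ≡ 𝟙 ((a ∧ c) ∧ b)
  nested-if false b     c     = refl
  nested-if true  false false = refl
  nested-if true  false true  = refl
  nested-if true  true  false = refl
  nested-if true  true  true  = refl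

module _ {k : ℕ} (0<k : 0 < k) where

  private
    n = suc k

    χ : List ℕ → Std3 → Tableau → ℕ
    χ z t S = 𝟙 (hasShapeAndType k z t S)

    supported : ∀ z t S → χ z t S ≢ 0 → T (ofShape k z S)
    supported z t S ne = proj₁ (T-∧⁻ (ofShape k z S) (𝟙≢0⇒T _ ne))

    wrong-shape : ∀ z t S → ¬ shape S ≡ z → χ z t S ≡ 0
    wrong-shape z t S s≢z = ¬T⇒𝟙≡0 _ λ p →
      s≢z (proj₂ (Equivalence.to (ofShape⇔ k z S) (proj₁ (T-∧⁻ (ofShape k z S) p))))

    Ta-not-hook : ∀ {t} → Hook t → (Ta ≟ᵇ t) ≡ false
    Ta-not-hook hookB = refl
    Ta-not-hook hookC = refl

  χ-[] : ∀ z t → χ z t [] ≡ 0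
  χ-[] z t = ¬T⇒𝟙≡0 _ λ p →
    let valid = proj₁ (Equivalence.to (ofShape⇔ k z []) (proj₁ (T-∧⁻ (ofShape k z []) p)))
        _ , 0≡k , _ = Equivalence.to (isSSYTkkk⇔ k []) valid
    in <-irrefl 0≡k 0<k

  ∑rows₁-vanishes : ∀ {t} → Hook t → ∀ z → ∑rows₁ n (χ z t) ≡ 0
  ∑rows₁-vanishes {t} hk z = ∑³-zero n λ a b c → cong 𝟙 (trans
    (∧-congˡ-T (ofShape k z (row a b c ∷ [])) {type k (row a b c ∷ []) ≟ᵇ t} λ p →
      let a≡ , b≡ , c≡ = valid₁⇒ {k} {a} {b} {c} (proj₁ (Equivalence.to (ofShape⇔ k z (row a b c ∷ [])) p))
      in trans (cong (_≟ᵇ t) (type-1row k a≡ b≡ c≡)) (Ta-not-hook hk))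
    (∧-zeroʳ _))

  ∑rows₂-vanishes : ∀ z t → (∀ l₁ l₂ → z ≢ l₁ ∷ l₂ ∷ []) → ∑rows₂ n (χ z t) ≡ 0
  ∑rows₂-vanishes z t ne = ∑³-zero n λ a₁ b₁ c₁ → ∑³-zero n λ a₂ b₂ c₂ →
    wrong-shape z t (row a₁ b₁ c₁ ∷ row a₂ b₂ c₂ ∷ []) λ s≡z → ne _ _ (sym s≡z)

  ∑rows₃-vanishes : ∀ z t → (∀ l₁ l₂ l₃ → z ≢ l₁ ∷ l₂ ∷ l₃ ∷ []) → ∑rows₃ n (χ z t) ≡ 0
  ∑rows₃-vanishes z t ne = ∑³-zero n λ a₁ b₁ c₁ → ∑³-zero n λ a₂ b₂ c₂ → ∑³-zero n λ a₃ b₃ c₃ →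
    wrong-shape z t (row a₁ b₁ c₁ ∷ row a₂ b₂ c₂ ∷ row a₃ b₃ c₃ ∷ []) λ s≡z → ne _ _ _ (sym s≡z)

  ∑rows₂-by-parity : ∀ {t} (hk : Hook t) x y → let z = x ∷ y ∷ [] in
    ∑rows₂ n (χ z t) ≡ ∑< n (λ d → 𝟙 ((ofShape k z (canonical₂ k y d) ∧ not (big (d ∸ 0) (y ∸ d))) ∧ parity hk d))
  ∑rows₂-by-parity {t} hk x y = trans (∑rows₂-canonical k y x (χ z t) (supported z t)) (∑<-cong n λ d _ →
    cong 𝟙 (hook-split hk (ofShape k z (canonical₂ k y d)) {type k (canonical₂ k y d)} {d} {y ∸ d} {0} λ p →
      type-canonical₂ {k} {y} {d} (proj₁ (Equivalence.to (ofShape⇔ k z (canonical₂ k y d)) p))))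
    where z = x ∷ y ∷ []

  ∑rows₃-by-parity : ∀ {t} (hk : Hook t) x y w → let z = x ∷ y ∷ w ∷ [] in
    ∑rows₃ n (χ z t) ≡ ∑< n (λ d → 𝟙 ((ofShape k z (canonical₃ k y w d) ∧ not (big (d ∸ w) (y ∸ d))) ∧ parity hk d))
  ∑rows₃-by-parity {t} hk x y w = trans (∑rows₃-canonical k y w x (χ z t) (supported z t)) (∑<-cong n λ d _ →
    cong 𝟙 (hook-split hk (ofShape k z (canonical₃ k y w d)) {type k (canonical₃ k y w d)} {d} {y ∸ d} {w} λ p →
      type-canonical₃ {k} {y} {w} {d} (proj₁ (Equivalence.to (ofShape⇔ k z (canonical₃ k y w d)) p))))
    where z = x ∷ y ∷ w ∷ []

  ∑rows₂-balanced : ∀ z → ∑rows₂ n (χ z Tb) ≡ ∑rows₂ n (χ z Tc)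
  ∑rows₂-balanced (x ∷ y ∷ []) =
    trans (∑rows₂-by-parity hookB x y)
      (trans (hook-balance k y 0 (λ d → ofShape k (x ∷ y ∷ []) (canonical₂ k y d)) (x + y ≡ 3 * k × 0 < y)
                           (λ d → ofShape-canonical₂⇔ {k} {y} {d} {x} 0<k))
             (sym (∑rows₂-by-parity hookC x y)))
  ∑rows₂-balanced z@[]              = trans (∑rows₂-vanishes z Tb λ _ _ ()) (sym (∑rows₂-vanishes z Tc λ _ _ ()))
  ∑rows₂-balanced z@(_ ∷ [])        = trans (∑rows₂-vanishes z Tb λ _ _ ()) (sym (∑rows₂-vanishes z Tc λ _ _ ()))
  ∑rows₂-balanced z@(_ ∷ _ ∷ _ ∷ _) = trans (∑rows₂-vanishes z Tb λ _ _ ()) (sym (∑rows₂-vanishes z Tc λ _ _ ()))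

  ∑rows₃-balanced : ∀ z → ∑rows₃ n (χ z Tb) ≡ ∑rows₃ n (χ z Tc)
  ∑rows₃-balanced (x ∷ y ∷ w ∷ []) =
    trans (∑rows₃-by-parity hookB x y w)
      (trans (hook-balance k y w (λ d → ofShape k (x ∷ y ∷ w ∷ []) (canonical₃ k y w d)) (x + y + w ≡ 3 * k × 0 < w)
                           (λ d → ofShape-canonical₃⇔ {k} {y} {w} {d} {x} 0<k))
             (sym (∑rows₃-by-parity hookC x y w)))
  ∑rows₃-balanced z@[]               = trans (∑rows₃-vanishes z Tb λ _ _ _ ()) (sym (∑rows₃-vanishes z Tc λ _ _ _ ()))
  ∑rows₃-balanced z@(_ ∷ [])         = trans (∑rows₃-vanishes z Tb λ _ _ _ ()) (sym (∑rows₃-vanishes z Tc λ _ _ _ ()))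
  ∑rows₃-balanced z@(_ ∷ _ ∷ [])     = trans (∑rows₃-vanishes z Tb λ _ _ _ ()) (sym (∑rows₃-vanishes z Tc λ _ _ _ ()))
  ∑rows₃-balanced z@(_ ∷ _ ∷ _ ∷ _ ∷ _) =
    trans (∑rows₃-vanishes z Tb λ _ _ _ ()) (sym (∑rows₃-vanishes z Tc λ _ _ _ ()))

  multiplicity-Tb≡Tc : ∀ z → multiplicity _≟ₗ_ z (shapesOfType k Tb) ≡ multiplicity _≟ₗ_ z (shapesOfType k Tc)
  multiplicity-Tb≡Tc z = begin
    multiplicity _≟ₗ_ z (shapesOfType k Tb)
      ≡⟨ trans (multiplicity-shapesOfType k Tb z) (∑-candidates k (χ z Tb)) ⟩
    χ z Tb [] + (∑rows₁ n (χ z Tb) + (∑rows₂ n (χ z Tb) + ∑rows₃ n (χ z Tb)))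
      ≡⟨ cong₂ _+_ (trans (χ-[] z Tb) (sym (χ-[] z Tc)))
           (cong₂ _+_ (trans (∑rows₁-vanishes hookB z) (sym (∑rows₁-vanishes hookC z)))
             (cong₂ _+_ (∑rows₂-balanced z) (∑rows₃-balanced z))) ⟩
    χ z Tc [] + (∑rows₁ n (χ z Tc) + (∑rows₂ n (χ z Tc) + ∑rows₃ n (χ z Tc)))
      ≡⟨ sym (trans (multiplicity-shapesOfType k Tc z) (∑-candidates k (χ z Tc))) ⟩
    multiplicity _≟ₗ_ z (shapesOfType k Tc)
      ∎
    where open ≡-Reasoning

lemma5p6 : (k : ℕ) → k ≥ 1 → shapesOfType k Tb ↭ shapesOfType k Tc
lemma5p6 k k≥1 = ↭-from-multiplicity _≟ₗ_ (shapesOfType k Tb) (shapesOfType k Tc) (multiplicity-Tb≡Tc k≥1)
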